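{- Let $a_{2m}(q)$ be the area generating polynomial of convex polyominoes of half-perimeter $2m$ invariant under rotation by $90^\circ$. Then for $m\ge2$, $$a_{2m}(q)=q^{m^2}\left[\sum_{i=0}^{m-2}q^i\begin{bmatrix}m-2\\ i\end{bmatrix}_q\right]_{q\mapsto q^{ -4}},$$ where the bracket means the polynomial inside is evaluated at $q^{ -4}$ in place of $q$.
   Context: A polyomino is a finite edge-connected union of unit cells of the square lattice, up to translation; convex means its intersection with every horizontal and vertical line is connected. Half-perimeter is width plus height. $\begin{bmatrix}n\\k\end{bmatrix}_q$ is the Gaussian $q$-binomial coefficient. -}

module Defs where

open import Data.Nat as ℕ using (ℕ; zero; suc; _∸_; _≤ᵇ_)
open import Data.Integer as ℤ using (ℤ; +_; -_)
open import Data.Product using (_×_; _,_; ∃; ∃₂)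
open import Data.Sum using (_⊎_)
open import Data.Bool using (if_then_else_)
open import Data.List using (List; []; length; map; upTo)
open import Data.Nat.ListAction using (sum)
open import Data.List.Membership.Propositional using (_∈_)
open import Data.List.Relation.Unary.Unique.Propositional using (Unique)
open import Data.List.Relation.Unary.All using (All)
open import Data.List.Relation.Unary.Any using (Any)
open import Data.List.Relation.Unary.AllPairs using (AllPairs)
open import Relation.Binary.PropositionalEquality using (_≡_; _≢_)
open import Relation.Nullary using (¬_; does)
open import Function.Bundles using (_⇔_)

-- Cells of the square lattice: the unit cell with lower-left corner (x , y)

Cell : Set
Cell = ℤ × ℤ

Adjacent : Cell → Cell → Set
Adjacent (x , y) (x' , y') =
  (x ≡ x' × ℤ.∣ y ℤ.- y' ∣ ≡ 1) ⊎ (y ≡ y' × ℤ.∣ x ℤ.- x' ∣ ≡ 1)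

data Path (S : List Cell) : Cell → Cell → Set where
  stop : ∀ {c} → c ∈ S → Path S c c
  step : ∀ {c d e} → c ∈ S → Adjacent c d → Path S d e → Path S c e

record Polyomino : Set where
  field
    cells     : List Cell
    distinct  : Unique cells
    nonempty  : cells ≢ []
    connected : ∀ {c d} → c ∈ cells → d ∈ cells → Path cells c d
open Polyomino public

area : Polyomino → ℕ
area P = length (cells P)

translate : ℤ × ℤ → Cell → Cell
translate (a , b) (x , y) = (x ℤ.+ a , y ℤ.+ b)

_≈ₜ_ : Polyomino → Polyomino → Set
P ≈ₜ Q = ∃ λ v → ∀ c → (c ∈ cells P) ⇔ (translate v c ∈ cells Q)

-- rotation by 90° (counterclockwise) of the cell with lower-left corner
-- (x , y): the cell [x,x+1]×[y,y+1] goes to [-y-1,-y]×[x,x+1].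
rot90 : Cell → Cell
rot90 (x , y) = (ℤ.- y ℤ.- ℤ.+ 1 , x)

RotInvariant : Polyomino → Set
RotInvariant P = ∃ λ v → ∀ c → (c ∈ cells P) ⇔ (translate v (rot90 c) ∈ cells P)

Convex : Polyomino → Set
Convex P =
  (∀ x₁ x₂ x y → (x₁ , y) ∈ cells P → (x₂ , y) ∈ cells P →
     x₁ ℤ.≤ x → x ℤ.≤ x₂ → (x , y) ∈ cells P)
  × (∀ x y₁ y₂ y → (x , y₁) ∈ cells P → (x , y₂) ∈ cells P →
     y₁ ℤ.≤ y → y ℤ.≤ y₂ → (x , y) ∈ cells P)

HasWidth : Polyomino → ℕ → Set
HasWidth P w = ∃ λ x₀ →
  (∀ x y → (x , y) ∈ cells P → x₀ ℤ.≤ x × x ℤ.< x₀ ℤ.+ + w)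
  × (∃ λ y → (x₀ , y) ∈ cells P)
  × (∃ λ x → ∃ λ y → (x , y) ∈ cells P × x ℤ.+ + 1 ≡ x₀ ℤ.+ + w)

HasHeight : Polyomino → ℕ → Set
HasHeight P h = ∃ λ y₀ →
  (∀ x y → (x , y) ∈ cells P → y₀ ℤ.≤ y × y ℤ.< y₀ ℤ.+ + h)
  × (∃ λ x → (x , y₀) ∈ cells P)
  × (∃ λ x → ∃ λ y → (x , y) ∈ cells P × y ℤ.+ + 1 ≡ y₀ ℤ.+ + h)

HalfPerimeter : Polyomino → ℕ → Set
HalfPerimeter P n = ∃₂ λ w h → HasWidth P w × HasHeight P h × w ℕ.+ h ≡ n

-- The number of translation classes of polyominoes satisfying Q is n:
-- there is a list of n pairwise non-translate representatives satisfying Q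
-- such that every polyomino satisfying Q is a translate of one of them.
NumClasses : (Polyomino → Set) → ℕ → Set
NumClasses Q n = ∃ λ (l : List Polyomino) →
  length l ≡ n × All Q l × AllPairs (λ P R → ¬ (P ≈ₜ R)) l
  × (∀ P → Q P → Any (P ≈ₜ_) l)

-- a_{2m}(q): coefficient of q^k = number of rotation-invariant convex
-- polyominoes of half-perimeter 2m and area k (up to translation)
RotConvexAreaCount : ℕ → ℕ → ℕ → Set
RotConvexAreaCount m k c =
  NumClasses (λ P → Convex P × RotInvariant P × HalfPerimeter P (2 ℕ.* m)
                    × area P ≡ k) c

-- Polynomials as coefficient functions.

-- qbin n k j = coefficient of q^j in the Gaussian binomial [n choose k]_q,
-- via  [n+1, k+1] = [n, k] + q^(k+1) [n, k+1],  [n,0] = 1, [0,k+1] = 0.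
qbin : ℕ → ℕ → ℕ → ℕ
qbin n       zero    zero    = 1
qbin n       zero    (suc j) = 0
qbin zero    (suc k) j       = 0
qbin (suc n) (suc k) j       =
  qbin n k j ℕ.+ (if suc k ≤ᵇ j then qbin n (suc k) (j ∸ suc k) else 0)

-- coefficient of q^j in  P_m(q) = Σ_{i=0}^{m-2} q^i [m-2 choose i]_q
pcoef : ℕ → ℕ → ℕ
pcoef m j = sum (map (λ i → if i ≤ᵇ j then qbin (m ∸ 2) i (j ∸ i) else 0)
                     (upTo (suc (m ∸ 2))))

-- coefficient of q^k in  q^{m²} · P_m(q^{-4}) = Σ_j pcoef m j · q^{m² - 4j}
rhsCoef : ℕ → ℕ → ℕ
rhsCoef m k = sum (map (λ j → if does (k ℕ.+ 4 ℕ.* j ℕ.≟ m ℕ.* m) then pcoef m j else 0)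
                       (upTo (suc (m ℕ.* m))))

-- A convex polyomino invariant under a quarter turn has equal width and height,
-- here m, so placed in the box [0, m-1]² it is the box minus four staircases cut
-- from the corners, each the rotation of the previous one. The lower-left staircase
-- {x < f y} has antitone rows f y fitting in an a × c rectangle with a + c = m - 1,
-- because the polyomino touches all four sides of the box; conversely every such f
-- yields one polyomino, of area m² - 4 Σ f. Reading f as its first row a = f 0
-- followed by a partition with m - 2 - a parts bounded by a, the profiles of weight
-- Σ f = j, that is of area m² - 4j, are counted by the coefficient of qʲ in
-- Σₐ qᵃ [m-2 choose a]_q.

module Submission where

open import Defs
open import Data.Bool using (true; false; T; if_then_else_)
open import Data.Bool.Properties using (if-float)
open import Data.Empty using (⊥; ⊥-elim)
open import Data.Integer as ℤ using (ℤ; +_; -[1+_]; ∣_∣)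
open import Data.Integer.Properties using (drop‿+≤+; drop‿+<+; ∣i-j∣≡∣j-i∣)
import Data.Integer.Properties as ℤₚ
open import Algebra.Bundles using (AbelianGroup)
open import Algebra.Properties.Group (AbelianGroup.group ℤₚ.+-0-abelianGroup)
  using () renaming (∙-cancelˡ to ℤ+-cancelˡ; ∙-cancelʳ to ℤ+-cancelʳ)
open import Data.Integer.Tactic.RingSolver using (solve-∀)
open import Data.List
  using (List; []; _∷_; [_]; _++_; length; map; upTo; downFrom; applyUpTo; replicate; concatMap; filter)
open import Data.List.Properties using (length-++; length-map; map-cong; ∷-injectiveʳ; length-applyUpTo)
open import Data.List.Membership.Propositional using (_∈_; find; lose; mapWith∈)
open import Data.List.Membership.Propositional.Properties
  using (∈-++⁺ˡ; ∈-++⁺ʳ; ∈-++⁻; ∈-map⁺; ∈-map⁻; ∈-upTo⁺; ∈-downFrom⁺; ∈-concatMap⁺; ∈-concatMap⁻;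
         ∈-filter⁺; ∈-filter⁻)
open import Data.List.Membership.Propositional.Properties.WithK using (unique∧set⇒bag)
import Data.List.Membership.DecPropositional as DecMembership
open import Data.List.Relation.Binary.BagAndSetEquality using (∼bag⇒↭)
open import Data.List.Relation.Binary.Disjoint.Propositional using (Disjoint)
open import Data.List.Relation.Binary.Permutation.Propositional.Properties using (↭-length)
open import Data.List.Relation.Unary.All as All using (All; []; _∷_)
import Data.List.Relation.Unary.All.Properties as Allₚ
open import Data.List.Relation.Unary.AllPairs as AllPairs using (AllPairs; []; _∷_)
import Data.List.Relation.Unary.AllPairs.Properties as AllPairsₚ
open import Data.List.Relation.Unary.Any using (here; there)
open import Data.List.Relation.Unary.Any.Properties using (mapWith∈⁺)
open import Data.List.Relation.Unary.Unique.Propositional using (Unique)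
import Data.List.Relation.Unary.Unique.Propositional.Properties as Uniqueₚ
open import Data.Nat
  using (ℕ; zero; suc; pred; _+_; _*_; _∸_; _≤_; _<_; _≥_; z≤n; s≤s; _≤ᵇ_; _≟_; _≤?_; _<?_; _⊓_)
open import Data.Nat.ListAction using (sum)
open import Data.Nat.Properties
open import Algebra.Properties.CommutativeSemigroup +-commutativeSemigroup
  using (interchange; x∙yz≈y∙xz)
open import Data.Nat.Solver using (module +-*-Solver)
open import Data.Product using (Σ; ∃; ∃₂; _×_; _,_; proj₁; proj₂)
open import Data.Product.Properties using (≡-dec)
open import Data.Sum using (_⊎_; inj₁; inj₂)
open import Function using (_∘_)
open import Function.Bundles using (Equivalence; mk⇔)
open import Relation.Nullary using (¬_; Dec; yes; no; does; contradiction)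
open import Relation.Nullary.Decidable using (map′; _×-dec_)
open import Relation.Unary using (Decidable)
open import Relation.Binary.PropositionalEquality
  using (_≡_; _≢_; refl; sym; trans; cong; cong₂; subst; subst₂; module ≡-Reasoning)

open ≡-Reasoning

private variable
  A B : Set

length-concatMap : (g : A → List B) (xs : List A) →
                   length (concatMap g xs) ≡ sum (map (length ∘ g) xs)
length-concatMap g []       = refl
length-concatMap g (x ∷ xs) = trans (length-++ (g x)) (cong (_+_ (length (g x))) (length-concatMap g xs))

∈-concatMap⇒∃ : (g : A → List B) (xs : List A) {y : B} →
                y ∈ concatMap g xs → ∃ λ x → x ∈ xs × y ∈ g x
∈-concatMap⇒∃ g xs y∈ = find (∈-concatMap⁻ g y∈)

∃⇒∈-concatMap : (g : A → List B) {xs : List A} {x : A} {y : B} →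
                x ∈ xs → y ∈ g x → y ∈ concatMap g xs
∃⇒∈-concatMap g x∈ y∈ = ∈-concatMap⁺ g (lose x∈ y∈)

unique-concatMap : (g : A → List B) (key : B → A) →
                   (∀ {x y} → y ∈ g x → key y ≡ x) → (∀ x → Unique (g x)) →
                   {xs : List A} → Unique xs → Unique (concatMap g xs)
unique-concatMap g key keyed g! xs! =
  Uniqueₚ.concat⁺ (Allₚ.map⁺ (All.universal g! _))
                 (AllPairsₚ.map⁺ (AllPairs.map disjoint xs!))
  where
  disjoint : ∀ {x x'} → x ≢ x' → Disjoint (g x) (g x')
  disjoint x≢x' (y∈ , y∈') = x≢x' (trans (sym (keyed y∈)) (keyed y∈'))

∈-if⁻ : ∀ b {xs : List A} {x} → x ∈ (if b then xs else []) → T b × x ∈ xs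
∈-if⁻ true x∈ = _ , x∈

∈-if⁺ : ∀ b {xs : List A} {x} → T b → x ∈ xs → x ∈ (if b then xs else [])
∈-if⁺ true _ x∈ = x∈

unique-if : ∀ b {xs : List A} → Unique xs → Unique (if b then xs else [])
unique-if true  xs! = xs!
unique-if false _   = []

length-mapWith∈ : (xs : List A) (f : ∀ {x} → x ∈ xs → B) → length (mapWith∈ xs f) ≡ length xs
length-mapWith∈ []       f = refl
length-mapWith∈ (x ∷ xs) f = cong suc (length-mapWith∈ xs (f ∘ there))

All-mapWith∈ : ∀ {P : B → Set} (xs : List A) (f : ∀ {x} → x ∈ xs → B) →
               (∀ {x} (x∈ : x ∈ xs) → P (f x∈)) → All P (mapWith∈ xs f)
All-mapWith∈ []       f Pf = []
All-mapWith∈ (x ∷ xs) f Pf = Pf (here refl) ∷ All-mapWith∈ xs (f ∘ there) (Pf ∘ there)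

AllPairs-mapWith∈ : ∀ {R : B → B → Set} {xs : List A} (f : ∀ {x} → x ∈ xs → B) → Unique xs →
                    (∀ {x y} (x∈ : x ∈ xs) (y∈ : y ∈ xs) → x ≢ y → R (f x∈) (f y∈)) →
                    AllPairs R (mapWith∈ xs f)
AllPairs-mapWith∈ {xs = []}     f []          Rf = []
AllPairs-mapWith∈ {xs = x ∷ xs} f (x∉ ∷ xs!) Rf =
  All-mapWith∈ xs (f ∘ there) (λ y∈ → Rf (here refl) (there y∈) (All.lookup x∉ y∈)) ∷
  AllPairs-mapWith∈ (f ∘ there) xs! (λ x∈ y∈ → Rf (there x∈) (there y∈))

∑< : ℕ → (ℕ → ℕ) → ℕ
∑< zero    g = 0
∑< (suc n) g = g n + ∑< n g

syntax ∑< n (λ i → e) = ∑[ i < n ] e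

𝟙[_] : {P : Set} → Dec P → ℕ
𝟙[ yes _ ] = 1
𝟙[ no  _ ] = 0

𝟙-yes : {P : Set} (p? : Dec P) → P → 𝟙[ p? ] ≡ 1
𝟙-yes (yes _) _ = refl
𝟙-yes (no ¬p) p = ⊥-elim (¬p p)

𝟙-no : {P : Set} (p? : Dec P) → ¬ P → 𝟙[ p? ] ≡ 0
𝟙-no (yes p) ¬p = ⊥-elim (¬p p)
𝟙-no (no _)  _  = refl

∑<-cong : ∀ n {g h} → (∀ {i} → i < n → g i ≡ h i) → ∑< n g ≡ ∑< n h
∑<-cong zero    g≡h = refl
∑<-cong (suc n) g≡h = cong₂ _+_ (g≡h ≤-refl) (∑<-cong n (g≡h ∘ m≤n⇒m≤1+n))

∑<-distrib-+ : ∀ n g h → ∑[ i < n ] (g i + h i) ≡ ∑< n g + ∑< n h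
∑<-distrib-+ zero    g h = refl
∑<-distrib-+ (suc n) g h =
  trans (cong (_+_ (g n + h n)) (∑<-distrib-+ n g h)) (interchange (g n) (h n) (∑< n g) (∑< n h))

∑<-const : ∀ n k → ∑[ i < n ] k ≡ n * k
∑<-const zero    k = refl
∑<-const (suc n) k = cong (_+_ k) (∑<-const n k)

∑<-comm : ∀ m n (g : ℕ → ℕ → ℕ) → ∑[ y < n ] ∑[ x < m ] g x y ≡ ∑[ x < m ] ∑[ y < n ] g x y
∑<-comm m zero    g = sym (trans (∑<-const m 0) (*-zeroʳ m))
∑<-comm m (suc n) g = begin
  ∑[ x < m ] g x n + ∑[ y < n ] ∑[ x < m ] g x y  ≡⟨ cong (_+_ (∑[ x < m ] g x n)) (∑<-comm m n g) ⟩
  ∑[ x < m ] g x n + ∑[ x < m ] ∑[ y < n ] g x y  ≡⟨ ∑<-distrib-+ m (λ x → g x n) _ ⟨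
  ∑[ x < m ] (g x n + ∑[ y < n ] g x y)           ∎

∑<-suc : ∀ n g → ∑< (suc n) g ≡ g 0 + ∑[ i < n ] g (suc i)
∑<-suc zero    g = refl
∑<-suc (suc n) g = trans (cong (_+_ (g (suc n))) (∑<-suc n g)) (x∙yz≈y∙xz (g (suc n)) (g 0) _)

∑<-reverse : ∀ M g → ∑[ i < suc M ] g (M ∸ i) ≡ ∑< (suc M) g
∑<-reverse zero    g = refl
∑<-reverse (suc M) g = begin
  g (suc M ∸ suc M) + ∑[ i < suc M ] g (suc M ∸ i)
    ≡⟨ cong₂ _+_ (cong g (n∸n≡0 M)) (∑<-cong (suc M) (λ i<sM → cong g (+-∸-assoc 1 (≤-pred i<sM)))) ⟩
  g 0 + ∑[ i < suc M ] g (suc (M ∸ i))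
    ≡⟨ cong (_+_ (g 0)) (∑<-reverse M (g ∘ suc)) ⟩
  g 0 + ∑[ i < suc M ] g (suc i)
    ≡⟨ ∑<-suc (suc M) g ⟨
  ∑< (suc (suc M)) g ∎

∑<-𝟙-< : ∀ {b n} → b ≤ n → ∑[ x < n ] 𝟙[ x <? b ] ≡ b
∑<-𝟙-< {b} {n} b≤n = trans (count n) (m≥n⇒m⊓n≡n b≤n)
  where
  count : ∀ n → ∑[ x < n ] 𝟙[ x <? b ] ≡ n ⊓ b
  count zero    = refl
  count (suc n) with n <? b
  ... | yes n<b = trans (cong suc (trans (count n) (m≤n⇒m⊓n≡m (<⇒≤ n<b)))) (sym (m≤n⇒m⊓n≡m n<b))
  ... | no  n≮b =
    trans (count n) (trans (m≥n⇒m⊓n≡n n≥b) (sym (m≥n⇒m⊓n≡n (m≤n⇒m≤1+n n≥b))))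
    where
    n≥b : n ≥ b
    n≥b = ≮⇒≥ n≮b

∑<≡sum-downFrom : ∀ n g → ∑< n g ≡ sum (map g (downFrom n))
∑<≡sum-downFrom zero    g = refl
∑<≡sum-downFrom (suc n) g = cong (_+_ (g n)) (∑<≡sum-downFrom n g)

length-filter : ∀ {P : A → Set} (P? : Decidable P) xs →
                length (filter P? xs) ≡ sum (map (λ x → 𝟙[ P? x ]) xs)
length-filter P? []       = refl
length-filter P? (x ∷ xs) with P? x
... | yes _ = cong suc (length-filter P? xs)
... | no  _ = length-filter P? xs

entry : List ℕ → ℕ → ℕ
entry []       _       = 0
entry (x ∷ _)  zero    = x
entry (_ ∷ xs) (suc y) = entry xs y

entry-≤ : ∀ {b xs} → All (_≤ b) xs → ∀ y → entry xs y ≤ b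
entry-≤ []           y       = z≤n
entry-≤ (x≤b ∷ _)    zero    = x≤b
entry-≤ (_ ∷ xs≤b)   (suc y) = entry-≤ xs≤b y

entry-antitone : ∀ {xs} → AllPairs _≥_ xs → ∀ {y y'} → y ≤ y' → entry xs y' ≤ entry xs y
entry-antitone {[]}    _          _                             = z≤n
entry-antitone {_ ∷ _} _          {zero}  {zero}   _            = ≤-refl
entry-antitone {_ ∷ _} (x≥xs ∷ _) {zero}  {suc y'} _            = entry-≤ x≥xs y'
entry-antitone {_ ∷ _} (_ ∷ desc) {suc y} {suc y'} (s≤s y≤y') = entry-antitone desc y≤y'

entry-beyond : ∀ xs {y} → length xs ≤ y → entry xs y ≡ 0
entry-beyond []       _           = refl
entry-beyond (x ∷ xs) (s≤s len≤y) = entry-beyond xs len≤y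

entry-applyUpTo : ∀ (g : ℕ → ℕ) n {y} → y < n → entry (applyUpTo g n) y ≡ g y
entry-applyUpTo g (suc n) {zero}  _          = refl
entry-applyUpTo g (suc n) {suc y} (s≤s y<n) = entry-applyUpTo (g ∘ suc) n y<n

∑<-entry : ∀ xs n → length xs ≤ n → ∑< n (entry xs) ≡ sum xs
∑<-entry []       n       _         = trans (∑<-const n 0) (*-zeroʳ n)
∑<-entry (x ∷ xs) (suc n) (s≤s len≤n) =
  trans (∑<-suc n (entry (x ∷ xs))) (cong (_+_ x) (∑<-entry xs n len≤n))

entry-injective : ∀ xs ys → length xs ≡ length ys → (∀ y → entry xs y ≡ entry ys y) → xs ≡ ys
entry-injective []       []       _   _ = refl
entry-injective (x ∷ xs) (y ∷ ys) len e =
  cong₂ _∷_ (e 0) (entry-injective xs ys (suc-injective len) (e ∘ suc))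

-- Counting codes

-- Partitions with at most n ∸ k parts, each at most k, padded with zeros to
-- exactly n ∸ k parts; their generating function is [n choose k]_q.
InBox : ℕ → ℕ → List ℕ → Set
InBox n k rows = k ≤ n × length rows ≡ n ∸ k × AllPairs _≥_ rows × All (_≤ k) rows

boxPartitions : ℕ → ℕ → ℕ → List (List ℕ)
boxPartitions n       zero    zero    = [ replicate n 0 ]
boxPartitions n       zero    (suc j) = []
boxPartitions zero    (suc k) j       = []
boxPartitions (suc n) (suc k) j       =
  boxPartitions n k j
  ++ (if suc k ≤ᵇ j then map (suc k ∷_) (boxPartitions n (suc k) (j ∸ suc k)) else [])

length-boxPartitions : ∀ n k j → length (boxPartitions n k j) ≡ qbin n k j
length-boxPartitions n       zero    zero    = refl
length-boxPartitions n       zero    (suc j) = refl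
length-boxPartitions zero    (suc k) j       = refl
length-boxPartitions (suc n) (suc k) j       = begin
  length (boxPartitions n k j ++ withTop)
    ≡⟨ length-++ (boxPartitions n k j) ⟩
  length (boxPartitions n k j) + length withTop
    ≡⟨ cong₂ _+_ (length-boxPartitions n k j) (if-float length (suc k ≤ᵇ j)) ⟩
  qbin n k j + (if suc k ≤ᵇ j then length (map (suc k ∷_) rest) else 0)
    ≡⟨ cong (λ l → qbin n k j + (if suc k ≤ᵇ j then l else 0))
            (trans (length-map _ rest) (length-boxPartitions n (suc k) (j ∸ suc k))) ⟩
  qbin (suc n) (suc k) j ∎
  where
  rest withTop : List (List ℕ)
  rest = boxPartitions n (suc k) (j ∸ suc k)
  withTop = if suc k ≤ᵇ j then map (suc k ∷_) rest else []

replicate-inBox : ∀ n → InBox n 0 (replicate n 0) × sum (replicate n 0) ≡ 0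
replicate-inBox zero    = (z≤n , refl , [] , []) , refl
replicate-inBox (suc n) with (_ , len , desc , bnd) , s ← replicate-inBox n =
  (z≤n , cong suc len , bnd ∷ desc , z≤n ∷ bnd) , s

∈-boxPartitions⁻ : ∀ n k j {rows} → rows ∈ boxPartitions n k j → InBox n k rows × sum rows ≡ j
∈-boxPartitions⁻ n zero zero (here refl) = replicate-inBox n
∈-boxPartitions⁻ (suc n) (suc k) j rows∈ with ∈-++⁻ (boxPartitions n k j) rows∈
... | inj₁ rows∈ˡ with (k≤n , len , desc , bnd) , s ← ∈-boxPartitions⁻ n k j rows∈ˡ =
  (s≤s k≤n , len , desc , All.map m≤n⇒m≤1+n bnd) , s
... | inj₂ rows∈ʳ
  with sk≤j , rows∈′ ← ∈-if⁻ (suc k ≤ᵇ j) rows∈ʳ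
  with rest , rest∈ , refl ← ∈-map⁻ (suc k ∷_) rows∈′
  with (sk≤n , len , desc , bnd) , s ← ∈-boxPartitions⁻ n (suc k) (j ∸ suc k) rest∈ =
  (s≤s (<⇒≤ sk≤n) , trans (cong suc len) (sym (+-∸-assoc 1 sk≤n)) , bnd ∷ desc , ≤-refl ∷ bnd) ,
  trans (cong (_+_ (suc k)) s) (m+[n∸m]≡n (≤ᵇ⇒≤ (suc k) j sk≤j))

≤0⇒replicate : ∀ {rows} → All (_≤ 0) rows → rows ≡ replicate (length rows) 0
≤0⇒replicate []          = refl
≤0⇒replicate (z≤n ∷ bnd) = cong (0 ∷_) (≤0⇒replicate bnd)

∈-boxPartitions⁺ : ∀ n k j rows → InBox n k rows → sum rows ≡ j → rows ∈ boxPartitions n k j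
∈-boxPartitions⁺ n zero j rows (_ , len , _ , bnd) s =
  subst₂ (λ r i → r ∈ boxPartitions n 0 i) (sym rows≡0s)
         (trans (sym (proj₂ (replicate-inBox n))) (trans (cong sum (sym rows≡0s)) s)) (here refl)
  where
  rows≡0s : rows ≡ replicate n 0
  rows≡0s = trans (≤0⇒replicate bnd) (cong (λ l → replicate l 0) len)
∈-boxPartitions⁺ zero (suc k) j rows (() , _)
∈-boxPartitions⁺ (suc n) (suc k) j [] (s≤s k≤n , len , _ , _) s =
  ∈-++⁺ˡ (∈-boxPartitions⁺ n k j [] (k≤n , len , [] , []) s)
∈-boxPartitions⁺ (suc n) (suc k) j (x ∷ rest) (s≤s k≤n , len , x≥rest ∷ desc , x≤sk ∷ bnd) s
  with x ≤? k
... | yes x≤k =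
  ∈-++⁺ˡ (∈-boxPartitions⁺ n k j (x ∷ rest)
            (k≤n , len , x≥rest ∷ desc , x≤k ∷ All.map (λ y≤x → ≤-trans y≤x x≤k) x≥rest) s)
... | no x≰k with refl ← ≤-antisym x≤sk (≰⇒> x≰k) =
  ∈-++⁺ʳ (boxPartitions n k j)
    (∈-if⁺ (suc k ≤ᵇ j) (≤⇒≤ᵇ (subst (suc k ≤_) s (m≤m+n (suc k) (sum rest))))
      (∈-map⁺ (suc k ∷_)
        (∈-boxPartitions⁺ n (suc k) (j ∸ suc k) rest
          (m∸n≢0⇒n<m (λ n∸k≡0 → 1+n≢0 (trans len n∸k≡0)) ,
           trans (cong pred len) (pred[m∸n]≡m∸[1+n] n k) , desc , x≥rest)
          (trans (sym (m+n∸m≡n (suc k) (sum rest))) (cong (_∸ suc k) s)))))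

unique-boxPartitions : ∀ n k j → Unique (boxPartitions n k j)
unique-boxPartitions n       zero    zero    = [] ∷ []
unique-boxPartitions n       zero    (suc j) = []
unique-boxPartitions zero    (suc k) j       = []
unique-boxPartitions (suc n) (suc k) j       =
  Uniqueₚ.++⁺ (unique-boxPartitions n k j)
    (unique-if (suc k ≤ᵇ j) (Uniqueₚ.map⁺ ∷-injectiveʳ (unique-boxPartitions n (suc k) (j ∸ suc k))))
    startsBelow
  where
  -- the first summand lists those partitions whose largest part is below suc k
  startsBelow : Disjoint (boxPartitions n k j)
                         (if suc k ≤ᵇ j then map (suc k ∷_) (boxPartitions n (suc k) (j ∸ suc k)) else [])
  startsBelow (rows∈ˡ , rows∈ʳ)
    with _ , rows∈′ ← ∈-if⁻ (suc k ≤ᵇ j) rows∈ʳ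
    with _ , _ , refl ← ∈-map⁻ (suc k ∷_) rows∈′
    with (_ , _ , _ , sk≤k ∷ _) , _ ← ∈-boxPartitions⁻ n k j rows∈ˡ = 1+n≰n sk≤k

-- The code i ∷ rows contributes q^(i + sum rows) to the summand qⁱ [m-2 choose i]_q of P_m.
Code : ℕ → List ℕ → Set
Code m []         = ⊥
Code m (i ∷ rows) = InBox (m ∸ 2) i rows

codesWithHead : ℕ → ℕ → ℕ → List (List ℕ)
codesWithHead m j i = if i ≤ᵇ j then map (i ∷_) (boxPartitions (m ∸ 2) i (j ∸ i)) else []

codesOfWeight : ℕ → ℕ → List (List ℕ)
codesOfWeight m j = concatMap (codesWithHead m j) (upTo (suc (m ∸ 2)))

codesOfAreaAndWeight : ℕ → ℕ → ℕ → List (List ℕ)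
codesOfAreaAndWeight m k j = if does (k + 4 * j ≟ m * m) then codesOfWeight m j else []

codesOfArea : ℕ → ℕ → List (List ℕ)
codesOfArea m k = concatMap (codesOfAreaAndWeight m k) (upTo (suc (m * m)))

length-codesOfWeight : ∀ m j → length (codesOfWeight m j) ≡ pcoef m j
length-codesOfWeight m j =
  trans (length-concatMap (codesWithHead m j) (upTo (suc (m ∸ 2))))
        (cong sum (map-cong length-codesWithHead (upTo (suc (m ∸ 2)))))
  where
  length-codesWithHead : ∀ i → length (codesWithHead m j i)
                               ≡ (if i ≤ᵇ j then qbin (m ∸ 2) i (j ∸ i) else 0)
  length-codesWithHead i =
    trans (if-float length (i ≤ᵇ j))
          (cong (λ l → if i ≤ᵇ j then l else 0)
                (trans (length-map _ (boxPartitions (m ∸ 2) i (j ∸ i))) (length-boxPartitions (m ∸ 2) i (j ∸ i))))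

length-codesOfArea : ∀ m k → length (codesOfArea m k) ≡ rhsCoef m k
length-codesOfArea m k =
  trans (length-concatMap (codesOfAreaAndWeight m k) (upTo (suc (m * m))))
        (cong sum (map-cong length-codesOfAreaAndWeight (upTo (suc (m * m)))))
  where
  length-codesOfAreaAndWeight : ∀ j → length (codesOfAreaAndWeight m k j)
                                      ≡ (if does (k + 4 * j ≟ m * m) then pcoef m j else 0)
  length-codesOfAreaAndWeight j =
    trans (if-float length (does (k + 4 * j ≟ m * m)))
          (cong (λ l → if does (k + 4 * j ≟ m * m) then l else 0) (length-codesOfWeight m j))

∈-codesOfWeight⁻ : ∀ m j {F} → F ∈ codesOfWeight m j → Code m F × sum F ≡ j
∈-codesOfWeight⁻ m j F∈
  with i , _ , F∈′ ← ∈-concatMap⇒∃ (codesWithHead m j) (upTo (suc (m ∸ 2))) F∈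
  with i≤j , F∈″ ← ∈-if⁻ (i ≤ᵇ j) F∈′
  with rows , rows∈ , refl ← ∈-map⁻ (i ∷_) F∈″
  with inBox , s ← ∈-boxPartitions⁻ (m ∸ 2) i (j ∸ i) rows∈ =
  inBox , trans (cong (_+_ i) s) (m+[n∸m]≡n (≤ᵇ⇒≤ i j i≤j))

∈-codesOfWeight⁺ : ∀ m {F} → Code m F → F ∈ codesOfWeight m (sum F)
∈-codesOfWeight⁺ m {i ∷ rows} inBox@(i≤m-2 , _) =
  ∃⇒∈-concatMap (codesWithHead m (i + sum rows)) (∈-upTo⁺ (s≤s i≤m-2))
    (∈-if⁺ (i ≤ᵇ i + sum rows) (≤⇒≤ᵇ (m≤m+n i (sum rows)))
      (∈-map⁺ (i ∷_) (∈-boxPartitions⁺ (m ∸ 2) i _ rows inBox (sym (m+n∸m≡n i (sum rows))))))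

-- Opaque, as are the other existence proofs so marked below: they are used only
-- through their types, and unfolding them makes type checking blow up.
opaque
  ∈-codesOfArea⁻ : ∀ m k {F} → F ∈ codesOfArea m k → Code m F × k + 4 * sum F ≡ m * m
  ∈-codesOfArea⁻ m k {F} F∈
    with j , _ , F∈′ ← ∈-concatMap⇒∃ (codesOfAreaAndWeight m k) (upTo (suc (m * m))) F∈
    with area≡ , F∈″ ← ∈-if⁻ (does (k + 4 * j ≟ m * m)) F∈′
    with code , refl ← ∈-codesOfWeight⁻ m j F∈″ =
    code , ≡ᵇ⇒≡ (k + 4 * sum F) (m * m) area≡

∈-codesOfArea⁺ : ∀ m k {F} → Code m F → k + 4 * sum F ≡ m * m → F ∈ codesOfArea m k
∈-codesOfArea⁺ m k {F} code area≡ =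
  ∃⇒∈-concatMap (codesOfAreaAndWeight m k) (∈-upTo⁺ (s≤s weight≤))
    (∈-if⁺ (does (k + 4 * sum F ≟ m * m)) (≡⇒≡ᵇ (k + 4 * sum F) (m * m) area≡)
           (∈-codesOfWeight⁺ m code))
  where
  weight≤ : sum F ≤ m * m
  weight≤ = subst (sum F ≤_) area≡ (≤-trans (m≤n*m (sum F) 4) (m≤n+m (4 * sum F) k))

unique-codesOfWeight : ∀ m j → Unique (codesOfWeight m j)
unique-codesOfWeight m j =
  unique-concatMap (codesWithHead m j) head headed
    (λ i → unique-if (i ≤ᵇ j) (Uniqueₚ.map⁺ ∷-injectiveʳ (unique-boxPartitions (m ∸ 2) i (j ∸ i))))
    (Uniqueₚ.upTo⁺ (suc (m ∸ 2)))
  where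
  head : List ℕ → ℕ
  head []      = 0
  head (i ∷ _) = i
  headed : ∀ {i F} → F ∈ codesWithHead m j i → head F ≡ i
  headed {i} F∈ with _ , F∈′ ← ∈-if⁻ (i ≤ᵇ j) F∈
    with _ , _ , refl ← ∈-map⁻ (i ∷_) F∈′ = refl

unique-codesOfArea : ∀ m k → Unique (codesOfArea m k)
unique-codesOfArea m k =
  unique-concatMap (codesOfAreaAndWeight m k) sum weighed
    (λ j → unique-if (does (k + 4 * j ≟ m * m)) (unique-codesOfWeight m j)) (Uniqueₚ.upTo⁺ (suc (m * m)))
  where
  weighed : ∀ {j F} → F ∈ codesOfAreaAndWeight m k j → sum F ≡ j
  weighed {j} F∈ = proj₂ (∈-codesOfWeight⁻ m j (proj₂ (∈-if⁻ (does (k + 4 * j ≟ m * m)) F∈)))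

module BoundedMinimisation {P : ℕ → Set} (P? : Decidable P) where

  -- the least i ≤ n with P i, and n if there is none
  μ : ℕ → ℕ
  μ zero    = 0
  μ (suc n) with P? (μ n)
  ... | yes _ = μ n
  ... | no  _ = suc n

  μ≤ : ∀ n → μ n ≤ n
  μ≤ zero    = z≤n
  μ≤ (suc n) with P? (μ n)
  ... | yes _ = m≤n⇒m≤1+n (μ≤ n)
  ... | no  _ = ≤-refl

  μ-satisfies : ∀ {i n} → i ≤ n → P i → P (μ n)
  μ-satisfies {n = zero} z≤n pi = pi
  μ-satisfies {i} {suc n} i≤sn pi with P? (μ n)
  ... | yes pμ = pμ
  ... | no ¬pμ with i ≟ suc n
  ...   | yes refl = pi
  ...   | no  i≢sn = contradiction (μ-satisfies (≤-pred (≤∧≢⇒< i≤sn i≢sn)) pi) ¬pμ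

  μ-least : ∀ n {i} → P i → μ n ≤ i
  μ-least zero    pi = z≤n
  μ-least (suc n) {i} pi with P? (μ n)
  ... | yes _  = μ-least n pi
  ... | no ¬pμ with suc n ≤? i
  ...   | yes sn≤i = sn≤i
  ...   | no  sn≰i = contradiction (μ-satisfies (≤-pred (≰⇒> sn≰i)) pi) ¬pμ

-- Staircase shapes

-- f y is the length of row y of the staircase {x < f y} cut from the lower-left
-- corner of the box [0, M]².
record Profile (M : ℕ) (f : ℕ → ℕ) : Set where
  field
    a c       : ℕ
    a+c≡M     : a + c ≡ M
    antitone  : ∀ {y y'} → y ≤ y' → f y' ≤ f y
    f≤a       : ∀ y → f y ≤ a
    vanishes  : ∀ {y} → c ≤ y → f y ≡ 0

-- A cell of the box avoiding the lower-left staircase and its images under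
-- the rotations (x , y) ↦ (M ∸ y , x) of the box.
record InShape (M : ℕ) (f : ℕ → ℕ) (x y : ℕ) : Set where
  constructor inShape
  field
    x≤M : x ≤ M
    y≤M : y ≤ M
    ll  : f y ≤ x
    ul  : f x ≤ M ∸ y
    lr  : f (M ∸ x) ≤ y
    ur  : f (M ∸ y) ≤ M ∸ x

inShape? : ∀ M f x y → Dec (InShape M f x y)
inShape? M f x y =
  map′ (λ (p₁ , p₂ , p₃ , p₄ , p₅ , p₆) → inShape p₁ p₂ p₃ p₄ p₅ p₆)
       (λ (inShape p₁ p₂ p₃ p₄ p₅ p₆) → p₁ , p₂ , p₃ , p₄ , p₅ , p₆)
       (x ≤? M ×-dec y ≤? M ×-dec f y ≤? x ×-dec f x ≤? M ∸ y ×-dec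
        f (M ∸ x) ≤? y ×-dec f (M ∸ y) ≤? M ∸ x)

InShape-cong : ∀ {M f g} → (∀ z → f z ≡ g z) → ∀ {x y} → InShape M f x y → InShape M g x y
InShape-cong {M} f≗g {x} {y} (inShape x≤M y≤M ll ul lr ur) =
  inShape x≤M y≤M (subst (_≤ x) (f≗g y) ll) (subst (_≤ M ∸ y) (f≗g x) ul)
          (subst (_≤ y) (f≗g (M ∸ x)) lr) (subst (_≤ M ∸ x) (f≗g (M ∸ y)) ur)

module Staircase {M f} (profile : Profile M f) where

  open Profile profile

  private
    ≡0⇒≤ : ∀ {u v} → u ≡ 0 → u ≤ v
    ≡0⇒≤ refl = z≤n

  a≤M : a ≤ M
  a≤M = subst (a ≤_) a+c≡M (m≤m+n a c)

  c≤M : c ≤ M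
  c≤M = subst (c ≤_) a+c≡M (m≤n+m c a)

  M∸a≡c : M ∸ a ≡ c
  M∸a≡c = trans (cong (_∸ a) (sym a+c≡M)) (m+n∸m≡n a c)

  M∸c≡a : M ∸ c ≡ a
  M∸c≡a = trans (cong (_∸ c) (sym a+c≡M)) (m+n∸n≡m a c)

  f≤M : ∀ y → f y ≤ M
  f≤M y = ≤-trans (f≤a y) a≤M

  f≤M∸ : ∀ {x y} → y ≤ c → f x ≤ M ∸ y
  f≤M∸ {x} y≤c = ≤-trans (f≤a x) (subst (_≤ _) M∸c≡a (∸-monoʳ-≤ M y≤c))

  f[M∸z]≡0 : ∀ {z} → z ≤ a → f (M ∸ z) ≡ 0
  f[M∸z]≡0 {z} z≤a = vanishes (subst (_≤ M ∸ z) M∸a≡c (∸-monoʳ-≤ M z≤a))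

  f≢0⇒<c : ∀ {y} → f y ≢ 0 → y < c
  f≢0⇒<c {y} f≢0 with c ≤? y
  ... | yes c≤y = ⊥-elim (f≢0 (vanishes c≤y))
  ... | no  c≰y = ≰⇒> c≰y

  -- Nonzero rows lie below c, and two of them with y₁ + y₂ + 1 ≥ M force a < c.
  f+f≤M : ∀ y₁ y₂ → M ≤ suc (y₁ + y₂) → f y₁ + f y₂ ≤ M
  f+f≤M y₁ y₂ M≤ with f y₁ ≟ 0 | f y₂ ≟ 0
  ... | yes f₁≡0 | _        = subst (λ t → t + f y₂ ≤ M) (sym f₁≡0) (f≤M y₂)
  ... | no _     | yes f₂≡0 =
    subst (λ t → f y₁ + t ≤ M) (sym f₂≡0) (subst (_≤ M) (sym (+-identityʳ _)) (f≤M y₁))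
  ... | no f₁≢0  | no f₂≢0  =
    ≤-trans (+-mono-≤ (f≤a y₁) (f≤a y₂)) (subst (a + a ≤_) a+c≡M (+-monoʳ-≤ a (<⇒≤ a<c)))
    where
    a<c : a < c
    a<c = +-cancelʳ-< c a c (subst (_< c + c) (sym a+c≡M)
            (≤-trans (s≤s M≤) (subst (_≤ c + c) (cong suc (+-suc y₁ y₂))
                                     (+-mono-≤ (f≢0⇒<c f₁≢0) (f≢0⇒<c f₂≢0)))))

  f+f[M∸y]≤M : ∀ {y} → y ≤ M → f y + f (M ∸ y) ≤ M
  f+f[M∸y]≤M {y} y≤M =
    f+f≤M y (M ∸ y) (≤-trans (n≤1+n M) (≤-reflexive (cong suc (sym (m+[n∸m]≡n y≤M)))))

  Shape : ℕ → ℕ → Set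
  Shape = InShape M f

  rotate : ∀ {x y} → Shape x y → Shape (M ∸ y) x
  rotate {x} {y} (inShape x≤M y≤M ll ul lr ur) =
    inShape (m∸n≤m M y) x≤M ul ur
            (subst (λ t → f t ≤ x) (sym (m∸[m∸n]≡n y≤M)) ll)
            (subst (f (M ∸ x) ≤_) (sym (m∸[m∸n]≡n y≤M)) lr)

  rotate² : ∀ {x y} → Shape x y → Shape (M ∸ x) (M ∸ y)
  rotate² = rotate ∘ rotate

  row-convex : ∀ {x₁ x₂ x y} → Shape x₁ y → Shape x₂ y → x₁ ≤ x → x ≤ x₂ → Shape x y
  row-convex s₁ s₂ x₁≤x x≤x₂ =
    inShape (≤-trans x≤x₂ (InShape.x≤M s₂)) (InShape.y≤M s₁)
            (≤-trans (InShape.ll s₁) x₁≤x)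
            (≤-trans (antitone x₁≤x) (InShape.ul s₁))
            (≤-trans (antitone (∸-monoʳ-≤ M x≤x₂)) (InShape.lr s₂))
            (≤-trans (InShape.ur s₂) (∸-monoʳ-≤ M x≤x₂))

  column-convex : ∀ {x y₁ y₂ y} → Shape x y₁ → Shape x y₂ → y₁ ≤ y → y ≤ y₂ → Shape x y
  column-convex s₁ s₂ y₁≤y y≤y₂ =
    inShape (InShape.x≤M s₁) (≤-trans y≤y₂ (InShape.y≤M s₂))
            (≤-trans (antitone y₁≤y) (InShape.ll s₁))
            (≤-trans (InShape.ul s₂) (∸-monoʳ-≤ M y≤y₂))
            (≤-trans (InShape.lr s₁) y₁≤y)
            (≤-trans (antitone (∸-monoʳ-≤ M y≤y₂)) (InShape.ur s₂))

  diagonal : ∀ {y} → y ≤ c → Shape (f y) y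
  diagonal {y} y≤c =
    inShape (f≤M y) y≤M ≤-refl (f≤M∸ y≤c) (≡0⇒≤ (f[M∸z]≡0 (f≤a y)))
            (m+n≤o⇒m≤o∸n (f (M ∸ y)) (subst (_≤ M) (+-comm (f y) _) (f+f[M∸y]≤M y≤M)))
    where
    y≤M : y ≤ M
    y≤M = ≤-trans y≤c c≤M

  left-touch : Shape 0 c
  left-touch = subst (λ x → Shape x c) (vanishes ≤-refl) (diagonal ≤-refl)

  profile-lower-bound : ∀ {x y x' y'} → x' ≤ x → y' ≤ y → Shape x' y' → f y ≤ x
  profile-lower-bound x'≤x y'≤y s = ≤-trans (antitone y'≤y) (≤-trans (InShape.ll s) x'≤x)

  profile-attained : ∀ y → ∃₂ λ x' y' → x' ≤ f y × y' ≤ y × Shape x' y'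
  profile-attained y with y ≤? c
  ... | yes y≤c = f y , y , ≤-refl , ≤-refl , diagonal y≤c
  ... | no  y≰c = 0 , c , z≤n , <⇒≤ (≰⇒> y≰c) , left-touch

  rows-overlap-below-c : ∀ {y} → suc y ≤ c → Shape (f y) y × Shape (f y) (suc y)
  rows-overlap-below-c {y} sy≤c =
    diagonal (<⇒≤ sy≤c) ,
    inShape (f≤M y) sy≤M (antitone (n≤1+n y)) (f≤M∸ sy≤c) (≡0⇒≤ (f[M∸z]≡0 (f≤a y)))
            (m+n≤o⇒m≤o∸n (f (M ∸ suc y)) (subst (_≤ M) (+-comm (f y) _) (f+f≤M y (M ∸ suc y) M≤)))
    where
    sy≤M : suc y ≤ M
    sy≤M = ≤-trans sy≤c c≤M
    M≤ : M ≤ suc (y + (M ∸ suc y))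
    M≤ = ≤-reflexive (sym (m+[n∸m]≡n sy≤M))

  rows-overlap-between : ∀ {y} → suc y ≤ M → c ≤ y → c ≤ a → Shape c y × Shape c (suc y)
  rows-overlap-between {y} sy≤M c≤y c≤a = row c≤y (<⇒≤ sy≤M) , row (m≤n⇒m≤1+n c≤y) sy≤M
    where
    row : ∀ {y'} → c ≤ y' → y' ≤ M → Shape c y'
    row {y'} c≤y' y'≤M =
      inShape c≤M y'≤M (≡0⇒≤ (vanishes c≤y')) (≡0⇒≤ (vanishes ≤-refl))
              (≡0⇒≤ (subst (λ x → f x ≡ 0) (sym M∸c≡a) (vanishes c≤a)))
              (subst (f (M ∸ y') ≤_) (sym M∸c≡a) (f≤a (M ∸ y')))

  consecutive-rows-overlap : ∀ y → suc y ≤ M → ∃ λ x → Shape x y × Shape x (suc y)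
  consecutive-rows-overlap y sy≤M with suc y ≤? c | a ≤? y
  ... | yes sy≤c | _ = f y , rows-overlap-below-c sy≤c
  ... | no sy≰c | no a≰y =
    c , rows-overlap-between sy≤M c≤y (≤-trans c≤y (<⇒≤ (≰⇒> a≰y)))
    where
    c≤y : c ≤ y
    c≤y = ≤-pred (≰⇒> sy≰c)
  ... | no _    | yes a≤y =
    -- the mirror image of the first case under the half-turn of the box
    M ∸ f y' ,
    subst (Shape (M ∸ f y')) M∸sy'≡y (rotate² upper) , subst (Shape (M ∸ f y')) M∸y'≡sy (rotate² lower)
    where
    y' : ℕ
    y' = M ∸ suc y
    M∸y'≡sy : M ∸ y' ≡ suc y
    M∸y'≡sy = m∸[m∸n]≡n sy≤M
    M∸sy'≡y : M ∸ suc y' ≡ y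
    M∸sy'≡y = trans (cong (M ∸_) (sym (+-∸-assoc 1 sy≤M))) (m∸[m∸n]≡n (<⇒≤ sy≤M))
    sy'≤c : suc y' ≤ c
    sy'≤c = subst (_≤ c) (+-∸-assoc 1 sy≤M) (subst (M ∸ y ≤_) M∸a≡c (∸-monoʳ-≤ M a≤y))
    lower : Shape (f y') y'
    lower = proj₁ (rows-overlap-below-c sy'≤c)
    upper : Shape (f y') (suc y')
    upper = proj₂ (rows-overlap-below-c sy'≤c)

  private
    no-room : ∀ {x u v} → x ≤ M → x < u → M ∸ x < v → u + v ≤ M → ⊥
    no-room {x} x≤M x<u M∸x<v u+v≤M =
      1+n≰n (≤-trans (n≤1+n (suc M))
                     (subst (_≤ M) (cong suc M+1≡) (≤-trans (+-mono-≤ x<u M∸x<v) u+v≤M)))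
      where
      M+1≡ : x + suc (M ∸ x) ≡ suc M
      M+1≡ = trans (+-suc x (M ∸ x)) (cong suc (m+[n∸m]≡n x≤M))

    ≮0 : ∀ {u v} → v ≡ 0 → ¬ u < v
    ≮0 refl ()

  ll⇒¬lr : ∀ {x y} → x < f y → ¬ y < f (M ∸ x)
  ll⇒¬lr {x} {y} ll = ≮0 (f[M∸z]≡0 (<⇒≤ (<-≤-trans ll (f≤a y))))

  ll⇒¬ul : ∀ {x y} → x < f y → ¬ M ∸ y < f x
  ll⇒¬ul {x} {y} ll = ≤⇒≯ (f≤M∸ (<⇒≤ (f≢0⇒<c (λ f≡0 → ≮0 f≡0 ll))))

  ll⇒¬ur : ∀ {x y} → x ≤ M → y ≤ M → x < f y → ¬ M ∸ x < f (M ∸ y)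
  ll⇒¬ur x≤M y≤M ll ur = no-room x≤M ll ur (f+f[M∸y]≤M y≤M)

  lr⇒¬ur : ∀ {x y} → y < f (M ∸ x) → ¬ M ∸ x < f (M ∸ y)
  lr⇒¬ur {x} {y} lr = ≮0 (f[M∸z]≡0 (<⇒≤ (<-≤-trans lr (f≤a (M ∸ x)))))

  lr⇒¬ul : ∀ {x y} → x ≤ M → y ≤ M → y < f (M ∸ x) → ¬ M ∸ y < f x
  lr⇒¬ul {x} x≤M y≤M lr ul = no-room y≤M lr ul (subst (_≤ M) (+-comm (f x) _) (f+f[M∸y]≤M x≤M))

  ur⇒¬ul : ∀ {x y} → x ≤ M → M ∸ x < f (M ∸ y) → ¬ M ∸ y < f x
  ur⇒¬ul {x} {y} x≤M ur =
    ≮0 (trans (cong f (sym (m∸[m∸n]≡n x≤M))) (f[M∸z]≡0 (<⇒≤ (<-≤-trans ur (f≤a (M ∸ y))))))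

  𝟙-ll 𝟙-lr 𝟙-ur 𝟙-ul 𝟙-cutouts : ℕ → ℕ → ℕ
  𝟙-ll x y = 𝟙[ x <? f y ]
  𝟙-lr x y = 𝟙[ y <? f (M ∸ x) ]
  𝟙-ur x y = 𝟙[ M ∸ x <? f (M ∸ y) ]
  𝟙-ul x y = 𝟙[ M ∸ y <? f x ]
  𝟙-cutouts x y = 𝟙-ll x y + 𝟙-lr x y + 𝟙-ur x y + 𝟙-ul x y

  box-partition : ∀ {x y} → x ≤ M → y ≤ M → 𝟙[ inShape? M f x y ] + 𝟙-cutouts x y ≡ 1
  box-partition {x} {y} x≤M y≤M with x <? f y
  ... | yes ll = cong₂ (λ s t → s + suc t)
    (𝟙-no (inShape? M f x y) (λ s → <⇒≱ ll (InShape.ll s)))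
    (cong₂ _+_ (cong₂ _+_ (𝟙-no (y <? _) (ll⇒¬lr ll)) (𝟙-no (M ∸ x <? _) (ll⇒¬ur x≤M y≤M ll)))
               (𝟙-no (M ∸ y <? f x) (ll⇒¬ul ll)))
  ... | no ¬ll with y <? f (M ∸ x)
  ...   | yes lr = cong₂ (λ s t → s + suc t)
    (𝟙-no (inShape? M f x y) (λ s → <⇒≱ lr (InShape.lr s)))
    (cong₂ _+_ (𝟙-no (M ∸ x <? _) (lr⇒¬ur {x} {y} lr)) (𝟙-no (M ∸ y <? f x) (lr⇒¬ul x≤M y≤M lr)))
  ...   | no ¬lr with M ∸ x <? f (M ∸ y)
  ...     | yes ur = cong₂ (λ s t → s + suc t)
    (𝟙-no (inShape? M f x y) (λ s → <⇒≱ ur (InShape.ur s)))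
    (𝟙-no (M ∸ y <? f x) (ur⇒¬ul {x} {y} x≤M ur))
  ...     | no ¬ur with M ∸ y <? f x
  ...       | yes ul = cong (_+ 1) (𝟙-no (inShape? M f x y) (λ s → <⇒≱ ul (InShape.ul s)))
  ...       | no ¬ul =
    cong (_+ 0) (𝟙-yes (inShape? M f x y)
                       (inShape x≤M y≤M (≮⇒≥ ¬ll) (≮⇒≥ ¬ul) (≮⇒≥ ¬lr) (≮⇒≥ ¬ur)))

  ∑□ : (ℕ → ℕ → ℕ) → ℕ
  ∑□ g = ∑[ y < suc M ] ∑[ x < suc M ] g x y

  ∑□-cong : ∀ {g h} → (∀ {x y} → x ≤ M → y ≤ M → g x y ≡ h x y) → ∑□ g ≡ ∑□ h
  ∑□-cong g≡h =
    ∑<-cong (suc M) (λ y<sM → ∑<-cong (suc M) (λ x<sM → g≡h (≤-pred x<sM) (≤-pred y<sM)))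

  ∑□-distrib-+ : ∀ g h → ∑□ (λ x y → g x y + h x y) ≡ ∑□ g + ∑□ h
  ∑□-distrib-+ g h =
    trans (∑<-cong (suc M) (λ {y} _ → ∑<-distrib-+ (suc M) (λ x → g x y) (λ x → h x y)))
          (∑<-distrib-+ (suc M) (λ y → ∑[ x < suc M ] g x y) (λ y → ∑[ x < suc M ] h x y))

  private
    ∑-𝟙-<f : ∀ y → ∑[ x < suc M ] 𝟙[ x <? f y ] ≡ f y
    ∑-𝟙-<f y = ∑<-𝟙-< (m≤n⇒m≤1+n (f≤M y))

    ∑-𝟙-<f-reversed : ∀ y → ∑[ x < suc M ] 𝟙[ M ∸ x <? f y ] ≡ f y
    ∑-𝟙-<f-reversed y = trans (∑<-reverse M (λ x → 𝟙[ x <? f y ])) (∑-𝟙-<f y)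

  ∑ᶠ : ℕ
  ∑ᶠ = ∑< (suc M) f

  ∑-lower-left : ∑□ 𝟙-ll ≡ ∑ᶠ
  ∑-lower-left = ∑<-cong (suc M) (λ {y} _ → ∑-𝟙-<f y)

  ∑-lower-right : ∑□ 𝟙-lr ≡ ∑ᶠ
  ∑-lower-right = begin
    ∑□ 𝟙-lr                                            ≡⟨ ∑<-comm (suc M) (suc M) _ ⟩
    ∑[ x < suc M ] ∑[ y < suc M ] 𝟙[ y <? f (M ∸ x) ]
      ≡⟨ ∑<-cong (suc M) (λ {x} _ → ∑-𝟙-<f (M ∸ x)) ⟩
    ∑[ x < suc M ] f (M ∸ x)                           ≡⟨ ∑<-reverse M f ⟩
    ∑ᶠ                                                 ∎

  ∑-upper-right : ∑□ 𝟙-ur ≡ ∑ᶠ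
  ∑-upper-right = trans (∑<-cong (suc M) (λ {y} _ → ∑-𝟙-<f-reversed (M ∸ y))) (∑<-reverse M f)

  ∑-upper-left : ∑□ 𝟙-ul ≡ ∑ᶠ
  ∑-upper-left = trans (∑<-comm (suc M) (suc M) _) (∑<-cong (suc M) (λ {x} _ → ∑-𝟙-<f-reversed x))

  area-identity : ∑□ (λ x y → 𝟙[ inShape? M f x y ]) + 4 * ∑ᶠ ≡ suc M * suc M
  area-identity = begin
    ∑□ 𝟙S + 4 * ∑ᶠ
      ≡⟨ cong (_+_ (∑□ 𝟙S)) four-cutouts ⟨
    ∑□ 𝟙S + ∑□ 𝟙-cutouts
      ≡⟨ ∑□-distrib-+ 𝟙S 𝟙-cutouts ⟨
    ∑□ (λ x y → 𝟙S x y + 𝟙-cutouts x y)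
      ≡⟨ ∑□-cong box-partition ⟩
    ∑□ (λ _ _ → 1)
      ≡⟨ trans (∑<-cong (suc M) (λ _ → trans (∑<-const (suc M) 1) (*-identityʳ (suc M))))
               (∑<-const (suc M) (suc M)) ⟩
    suc M * suc M ∎
    where
    𝟙S : ℕ → ℕ → ℕ
    𝟙S x y = 𝟙[ inShape? M f x y ]
    open +-*-Solver using (solve; _:+_; _:*_; _:=_; con)
    four-cutouts : ∑□ 𝟙-cutouts ≡ 4 * ∑ᶠ
    four-cutouts = begin
      ∑□ 𝟙-cutouts
        ≡⟨ ∑□-distrib-+ (λ x y → 𝟙-ll x y + 𝟙-lr x y + 𝟙-ur x y) 𝟙-ul ⟩
      ∑□ (λ x y → 𝟙-ll x y + 𝟙-lr x y + 𝟙-ur x y) + ∑□ 𝟙-ul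
        ≡⟨ cong (_+ ∑□ 𝟙-ul) (∑□-distrib-+ (λ x y → 𝟙-ll x y + 𝟙-lr x y) 𝟙-ur) ⟩
      ∑□ (λ x y → 𝟙-ll x y + 𝟙-lr x y) + ∑□ 𝟙-ur + ∑□ 𝟙-ul
        ≡⟨ cong (λ t → t + ∑□ 𝟙-ur + ∑□ 𝟙-ul) (∑□-distrib-+ 𝟙-ll 𝟙-lr) ⟩
      ∑□ 𝟙-ll + ∑□ 𝟙-lr + ∑□ 𝟙-ur + ∑□ 𝟙-ul
        ≡⟨ cong₂ _+_ (cong₂ _+_ (cong₂ _+_ ∑-lower-left ∑-lower-right) ∑-upper-right) ∑-upper-left ⟩
      ∑ᶠ + ∑ᶠ + ∑ᶠ + ∑ᶠ
        ≡⟨ solve 1 (λ s → s :+ s :+ s :+ s := con 4 :* s) refl ∑ᶠ ⟩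
      4 * ∑ᶠ ∎

-- Rotation-invariant regions of a box

record RotationInvariantRegion (M : ℕ) (S : ℕ → ℕ → Set) : Set where
  field
    S?            : ∀ x y → Dec (S x y)
    bounded       : ∀ {x y} → S x y → x ≤ M × y ≤ M
    row-convex    : ∀ {x₁ x₂ x y} → S x₁ y → S x₂ y → x₁ ≤ x → x ≤ x₂ → S x y
    column-convex : ∀ {x y₁ y₂ y} → S x y₁ → S x y₂ → y₁ ≤ y → y ≤ y₂ → S x y
    rotate        : ∀ {x y} → S x y → S (M ∸ y) x
    -- the form in which edge-connectivity enters
    rows-overlap  : ∀ y → suc y ≤ M → ∃ λ x → S x y × S x (suc y)
    bottom        : ∃ λ x → S x 0

module ProfileOfRegion {M S} (region : RotationInvariantRegion M S) where

  open RotationInvariantRegion region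

  rotate⁻¹ : ∀ {x y} → S x y → S y (M ∸ x)
  rotate⁻¹ {x} s = subst (λ t → S t (M ∸ x)) (m∸[m∸n]≡n (proj₂ (bounded s))) (rotate (rotate (rotate s)))

  rotate² : ∀ {x y} → S x y → S (M ∸ x) (M ∸ y)
  rotate² = rotate ∘ rotate

  -- Walking through the overlaps of consecutive rows either stays weakly left of
  -- column X or, by row convexity, runs into column X.
  walk-up : ∀ {x₁ y₁ X} t → S x₁ y₁ → x₁ ≤ X → y₁ + t ≤ M →
            (∃ λ x → x ≤ X × S x (y₁ + t)) ⊎ (∃ λ y → y ≤ y₁ + t × S X y)
  walk-up {x₁} {y₁} zero s x₁≤X _ = inj₁ (x₁ , x₁≤X , subst (S x₁) (sym (+-identityʳ y₁)) s)
  walk-up {x₁} {y₁} {X} (suc t) s x₁≤X y₁+st≤M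
    with walk-up t s x₁≤X (≤-trans (+-monoʳ-≤ y₁ (n≤1+n t)) y₁+st≤M)
  ... | inj₂ (y , y≤ , sX) = inj₂ (y , ≤-trans y≤ (+-monoʳ-≤ y₁ (n≤1+n t)) , sX)
  ... | inj₁ (x , x≤X , sx) with rows-overlap (y₁ + t) (subst (_≤ M) (+-suc y₁ t) y₁+st≤M)
  ...   | x° , s° , s°′ with x° ≤? X
  ...     | yes x°≤X = inj₁ (x° , x°≤X , subst (S x°) (sym (+-suc y₁ t)) s°′)
  ...     | no  x°≰X =
    inj₂ (y₁ + t , +-monoʳ-≤ y₁ (n≤1+n t) , row-convex sx s° x≤X (<⇒≤ (≰⇒> x°≰X)))

  walk-down : ∀ {y X} t {x₂} → S x₂ (y + t) → x₂ ≤ X →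
              (∃ λ x → x ≤ X × S x y) ⊎ (∃ λ y' → y ≤ y' × S X y')
  walk-down {y} zero {x₂} s x₂≤X = inj₁ (x₂ , x₂≤X , subst (S x₂) (+-identityʳ y) s)
  walk-down {y} {X} (suc t) {x₂} s x₂≤X
    with rows-overlap (y + t) (subst (_≤ M) (+-suc y t) (proj₂ (bounded s)))
  ... | x° , s° , s°′ with x° ≤? X
  ...   | yes x°≤X = walk-down t s° x°≤X
  ...   | no  x°≰X =
    inj₂ (y + suc t , m≤m+n y (suc t) ,
          row-convex s (subst (S x°) (sym (+-suc y t)) s°′) x₂≤X (<⇒≤ (≰⇒> x°≰X)))

  reach-left : ∀ {x₁ y₁ x₂ y₂ X y} → S x₁ y₁ → S x₂ y₂ → x₁ ≤ X → x₂ ≤ X →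
               y₁ ≤ y → y ≤ y₂ → ∃ λ x → x ≤ X × S x y
  reach-left {y₁ = y₁} {x₂} {y₂} {X} {y} s₁ s₂ x₁≤X x₂≤X y₁≤y y≤y₂
    with walk-up (y ∸ y₁) s₁ x₁≤X
           (subst (_≤ M) (sym (m+[n∸m]≡n y₁≤y)) (≤-trans y≤y₂ (proj₂ (bounded s₂))))
       | walk-down (y₂ ∸ y) (subst (S x₂) (sym (m+[n∸m]≡n y≤y₂)) s₂) x₂≤X
  ... | inj₁ (x , x≤X , s) | _      = x , x≤X , subst (S x) (m+[n∸m]≡n y₁≤y) s
  ... | inj₂ _             | inj₁ r = r
  ... | inj₂ (u , u≤ , su) | inj₂ (v , y≤v , sv) =
    X , ≤-refl , column-convex su sv (subst (u ≤_) (m+[n∸m]≡n y₁≤y) u≤) y≤v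

  reach-right : ∀ {x₁ y₁ x₂ y₂ X y} → S x₁ y₁ → S x₂ y₂ → X ≤ x₁ → X ≤ x₂ →
                y₁ ≤ y → y ≤ y₂ → ∃ λ x → X ≤ x × S x y
  reach-right {x₁} {y₁} {x₂} {y₂} {X} {y} s₁ s₂ X≤x₁ X≤x₂ y₁≤y y≤y₂
    with x , x≤M∸X , s ← reach-left (rotate² s₂) (rotate² s₁) (∸-monoʳ-≤ M X≤x₂) (∸-monoʳ-≤ M X≤x₁)
                                    (∸-monoʳ-≤ M y≤y₂) (∸-monoʳ-≤ M y₁≤y) =
    M ∸ x , X≤M∸x , subst (S (M ∸ x)) (m∸[m∸n]≡n y≤M) (rotate² s)
    where
    y≤M : y ≤ M
    y≤M = ≤-trans y≤y₂ (proj₂ (bounded s₂))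
    X≤M : X ≤ M
    X≤M = ≤-trans X≤x₁ (proj₁ (bounded s₁))
    X≤M∸x : X ≤ M ∸ x
    X≤M∸x = m+n≤o⇒m≤o∸n X (subst (_≤ M) (+-comm x X) (m≤o∸n⇒m+n≤o x X≤M x≤M∸X))

  SouthWest : ℕ → ℕ → Set
  SouthWest x y = ∃₂ λ x' y' → x' ≤ x × y' ≤ y × S x' y'

  southWest? : ∀ y x → Dec (SouthWest x y)
  southWest? y x =
    map′ (λ (x' , x'<sx , y' , y'<sy , s) → x' , y' , ≤-pred x'<sx , ≤-pred y'<sy , s)
         (λ (x' , y' , x'≤x , y'≤y , s) → x' , s≤s x'≤x , y' , s≤s y'≤y , s)
         (anyUpTo? (λ x' → anyUpTo? (S? x') (suc y)) (suc x))

  profile : ℕ → ℕ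
  profile y = BoundedMinimisation.μ (southWest? y) M

  profile≤ : ∀ {x y} → SouthWest x y → profile y ≤ x
  profile≤ {y = y} = BoundedMinimisation.μ-least (southWest? y) M

  southWest-profile : ∀ y → SouthWest (profile y) y
  southWest-profile y with xb , sb ← bottom =
    BoundedMinimisation.μ-satisfies (southWest? y) (proj₁ (bounded sb)) (xb , 0 , ≤-refl , z≤n , sb)

  profile≤M : ∀ y → profile y ≤ M
  profile≤M y = BoundedMinimisation.μ≤ (southWest? y) M

  profile-antitone : ∀ {y y'} → y ≤ y' → profile y' ≤ profile y
  profile-antitone y≤y' with x , y'' , x≤ , y''≤y , s ← southWest-profile _ =
    profile≤ (x , y'' , x≤ , ≤-trans y''≤y y≤y' , s)

  to-shape : ∀ {x y} → S x y → InShape M profile x y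
  to-shape s =
    inShape (proj₁ (bounded s)) (proj₂ (bounded s))
            (profile≤ (_ , _ , ≤-refl , ≤-refl , s))
            (profile≤ (_ , _ , ≤-refl , ≤-refl , rotate s))
            (profile≤ (_ , _ , ≤-refl , ≤-refl , rotate⁻¹ s))
            (profile≤ (_ , _ , ≤-refl , ≤-refl , rotate² s))

  private
    weaken : ∀ {x y} → profile y ≤ x → SouthWest x y
    weaken {x} {y} p≤x with u , v , u≤ , v≤ , s ← southWest-profile y = u , v , ≤-trans u≤ p≤x , v≤ , s

    flip : ∀ {z u} → z ≤ M → u ≤ M ∸ z → z ≤ M ∸ u
    flip {z} {u} z≤M u≤M∸z = subst (_≤ M ∸ u) (m∸[m∸n]≡n z≤M) (∸-monoʳ-≤ M u≤M∸z)

  -- The four corner conditions provide cells of S weakly south-west, north-west,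
  -- south-east and north-east of (x , y); walking to row y and row convexity conclude.
  from-shape : ∀ {x y} → InShape M profile x y → S x y
  from-shape {x} {y} (inShape x≤M y≤M ll ul lr ur)
    with x₁ , y₁ , x₁≤x , y₁≤y , s₁ ← weaken ll
       | u₂ , v₂ , u₂≤M∸y , v₂≤x , s₂ ← weaken ul
       | u₃ , v₃ , u₃≤y , v₃≤M∸x , s₃ ← weaken lr
       | u₄ , v₄ , u₄≤M∸x , v₄≤M∸y , s₄ ← weaken ur
    with xₗ , xₗ≤x , sₗ ← reach-left s₁ (rotate⁻¹ s₂) x₁≤x v₂≤x y₁≤y (flip y≤M u₂≤M∸y)
       | xᵣ , x≤xᵣ , sᵣ ← reach-right (rotate s₃) (rotate² s₄)
                            (flip x≤M v₃≤M∸x) (flip x≤M u₄≤M∸x) u₃≤y (flip y≤M v₄≤M∸y) =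
    row-convex sₗ sᵣ xₗ≤x x≤xᵣ

  isProfile : Profile M profile
  isProfile = record
    { a         = profile 0
    ; c         = M ∸ profile 0
    ; a+c≡M     = m+[n∸m]≡n (profile≤M 0)
    ; antitone  = profile-antitone
    ; f≤a       = λ _ → profile-antitone z≤n
    ; vanishes  = vanishes
    }
    where
    vanishes : ∀ {y} → M ∸ profile 0 ≤ y → profile y ≡ 0
    vanishes c≤y with xb , sb ← bottom with inShape _ _ ll _ lr _ ← to-shape sb =
      n≤0⇒n≡0 (≤-trans (profile-antitone (≤-trans (∸-monoʳ-≤ M ll) c≤y)) lr)

  profile0<M : 1 ≤ M → profile 0 < M
  profile0<M 1≤M = ≤∧≢⇒< (profile≤M 0) (λ p0≡M → 1+n≰n (subst (1 ≤_) (M≡0 p0≡M) 1≤M))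
    where
    M≡0 : profile 0 ≡ M → M ≡ 0
    M≡0 p0≡M = trans (sym p0≡M)
      (Profile.vanishes isProfile (≤-reflexive (trans (cong (M ∸_) p0≡M) (n∸n≡0 M))))

∣i-[1+i]∣≡1 : ∀ i → ∣ i ℤ.- (+ 1 ℤ.+ i) ∣ ≡ 1
∣i-[1+i]∣≡1 i = cong ∣_∣ (i-[1+i]≡-1 i)
  where
  i-[1+i]≡-1 : ∀ i → i ℤ.- (+ 1 ℤ.+ i) ≡ -[1+ 0 ]
  i-[1+i]≡-1 = solve-∀

∣[1+i]-i∣≡1 : ∀ i → ∣ (+ 1 ℤ.+ i) ℤ.- i ∣ ≡ 1
∣[1+i]-i∣≡1 i = trans (∣i-j∣≡∣j-i∣ (+ 1 ℤ.+ i) i) (∣i-[1+i]∣≡1 i)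

∣i-j∣≡1⇒j≡1+i⊎i≡1+j : ∀ i j → ∣ i ℤ.- j ∣ ≡ 1 → j ≡ ℤ.suc i ⊎ i ≡ ℤ.suc j
∣i-j∣≡1⇒j≡1+i⊎i≡1+j i j ∣i-j∣≡1 with ℤₚ.+∣i∣≡i⊎+∣i∣≡-i (i ℤ.- j)
... | inj₁ +∣i-j∣≡i-j =
  inj₂ (trans (sym (j+[i-j]≡i i j)) (cong (ℤ._+ j) (trans (sym +∣i-j∣≡i-j) (cong +_ ∣i-j∣≡1))))
  where
  j+[i-j]≡i : ∀ i j → (i ℤ.- j) ℤ.+ j ≡ i
  j+[i-j]≡i = solve-∀
... | inj₂ +∣i-j∣≡j-i =
  inj₁ (trans (sym (i+[j-i]≡j i j)) (cong (ℤ._+ i) (trans (sym +∣i-j∣≡j-i) (cong +_ ∣i-j∣≡1))))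
  where
  i+[j-i]≡j : ∀ i j → ℤ.- (i ℤ.- j) ℤ.+ i ≡ j
  i+[j-i]≡j = solve-∀

≥0∧-≥0⇒≡0 : ∀ {v} → (∃ λ x → v ≡ + x) → (∃ λ y → ℤ.- v ≡ + y) → v ≡ + 0
≥0∧-≥0⇒≡0 (zero , v≡0) _ = v≡0
≥0∧-≥0⇒≡0 (suc x , refl) (_ , ())

≤∧<suc⇒≡ : ∀ {i j} → i ℤ.≤ j → j ℤ.< ℤ.suc i → i ≡ j
≤∧<suc⇒≡ {i} i≤j j<1+i =
  ℤₚ.≤-antisym i≤j (subst (_ ℤ.≤_) (ℤₚ.pred-suc i) (ℤₚ.i<j⇒i≤pred[j] j<1+i))

ℤ+-cancelˡ-< : ∀ k {i j} → k ℤ.+ i ℤ.< k ℤ.+ j → i ℤ.< j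
ℤ+-cancelˡ-< k {i} {j} lt =
  subst₂ ℤ._<_ (-k+[k+i]≡i k i) (-k+[k+i]≡i k j) (ℤₚ.+-monoʳ-< (ℤ.- k) lt)
  where
  -k+[k+i]≡i : ∀ k i → ℤ.- k ℤ.+ (k ℤ.+ i) ≡ i
  -k+[k+i]≡i = solve-∀

≤⇒offset : ∀ {k X} → k ℤ.≤ X → ∃ λ u → X ≡ k ℤ.+ + u
≤⇒offset {k} {X} k≤X =
  ∣ X ℤ.- k ∣ ,
  trans (sym (k+[X-k]≡X k X)) (cong (ℤ._+_ k) (sym (ℤₚ.0≤i⇒+∣i∣≡i (ℤₚ.i≤j⇒0≤j-i k≤X))))
  where
  k+[X-k]≡X : ∀ k X → k ℤ.+ (X ℤ.- k) ≡ X
  k+[X-k]≡X = solve-∀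

nonnegative : ∀ {a X} → + a ℤ.≤ X → ∃ λ n → X ≡ + n
nonnegative (ℤ.+≤+ _) = _ , refl

cell : ℕ → ℕ → Cell
cell x y = (+ x , + y)

module _ {S : List Cell} where

  path-head : ∀ {c d} → Path S c d → c ∈ S
  path-head (stop c∈) = c∈
  path-head (step c∈ _ _) = c∈

  infixr 5 _++ₚ_
  _++ₚ_ : ∀ {c d e} → Path S c d → Path S d e → Path S c e
  stop _         ++ₚ q = q
  step c∈ c~d p ++ₚ q = step c∈ c~d (p ++ₚ q)

  Adjacent-sym : ∀ {c d} → Adjacent c d → Adjacent d c
  Adjacent-sym {x , y} {x' , y'} (inj₁ (x≡x' , ∣y-y'∣≡1)) =
    inj₁ (sym x≡x' , trans (∣i-j∣≡∣j-i∣ y' y) ∣y-y'∣≡1)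
  Adjacent-sym {x , y} {x' , y'} (inj₂ (y≡y' , ∣x-x'∣≡1)) =
    inj₂ (sym y≡y' , trans (∣i-j∣≡∣j-i∣ x' x) ∣x-x'∣≡1)

  reverseₚ : ∀ {c d} → Path S c d → Path S d c
  reverseₚ (stop c∈)       = stop c∈
  reverseₚ (step c∈ c~d p) = reverseₚ p ++ₚ step (path-head p) (Adjacent-sym c~d) (stop c∈)

crossing : ∀ {L c d} Y → Path L c d → proj₂ c ℤ.≤ Y → Y ℤ.< proj₂ d →
           ∃ λ X → (X , Y) ∈ L × (X , ℤ.suc Y) ∈ L
crossing Y (stop _) c≤Y Y<c = contradiction Y<c (ℤₚ.≤⇒≯ c≤Y)
crossing {L} {cx , cy} Y (step {d = dx , dy} c∈ c~d p) cy≤Y Y<e with dy ℤ.≤? Y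
... | yes dy≤Y = crossing Y p dy≤Y Y<e
... | no  dy≰Y with c~d
...   | inj₂ (cy≡dy , _) = contradiction (subst (ℤ._≤ Y) cy≡dy cy≤Y) dy≰Y
...   | inj₁ (cx≡dx , ∣cy-dy∣≡1) with ∣i-j∣≡1⇒j≡1+i⊎i≡1+j cy dy ∣cy-dy∣≡1
...     | inj₂ refl = contradiction (ℤₚ.≤-trans (ℤₚ.i≤suc[i] dy) cy≤Y) dy≰Y
...     | inj₁ refl with refl ← ≤∧<suc⇒≡ cy≤Y (ℤₚ.≰⇒> dy≰Y) =
  cx , c∈ , subst (λ x → (x , ℤ.suc cy) ∈ L) (sym cx≡dx) (path-head p)

quarterTurn : ℤ → Cell → Cell
quarterTurn K = translate (K , + 0) ∘ rot90

quarterTurn⁴≡id : ∀ K c → quarterTurn K (quarterTurn K (quarterTurn K (quarterTurn K c))) ≡ c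
quarterTurn⁴≡id K (X , Y) = cong₂ _,_ (first X K) (second Y K)
  where
  first : ∀ X K → ℤ.- ((ℤ.- (X ℤ.+ + 0) ℤ.- + 1 ℤ.+ K) ℤ.+ + 0) ℤ.- + 1 ℤ.+ K ≡ X
  first = solve-∀
  second : ∀ Y K → (ℤ.- ((ℤ.- Y ℤ.- + 1 ℤ.+ K) ℤ.+ + 0) ℤ.- + 1 ℤ.+ K) ℤ.+ + 0 ≡ Y
  second = solve-∀

translate-injective : ∀ v {c d} → translate v c ≡ translate v d → c ≡ d
translate-injective (a , b) e =
  cong₂ _,_ (ℤ+-cancelʳ a _ _ (cong proj₁ e)) (ℤ+-cancelʳ b _ _ (cong proj₂ e))

translate-inverse : ∀ a b d → translate (a , b) (translate (ℤ.- a , ℤ.- b) d) ≡ d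
translate-inverse a b (x , y) = cong₂ _,_ (shift x a) (shift y b)
  where
  shift : ∀ x a → (x ℤ.+ ℤ.- a) ℤ.+ a ≡ x
  shift = solve-∀

≈ₜ-sym : ∀ {P Q} → P ≈ₜ Q → Q ≈ₜ P
≈ₜ-sym {P} {Q} ((a , b) , P⇔Q) = (ℤ.- a , ℤ.- b) , λ d → mk⇔ (to d) (from d)
  where
  to : ∀ d → d ∈ cells Q → translate (ℤ.- a , ℤ.- b) d ∈ cells P
  to d d∈ = Equivalence.from (P⇔Q (translate (ℤ.- a , ℤ.- b) d))
                             (subst (_∈ cells Q) (sym (translate-inverse a b d)) d∈)
  from : ∀ d → translate (ℤ.- a , ℤ.- b) d ∈ cells P → d ∈ cells Q
  from d c∈ = subst (_∈ cells Q) (translate-inverse a b d) (Equivalence.to (P⇔Q _) c∈)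

area-translate : ∀ {P Q} → P ≈ₜ Q → area P ≡ area Q
area-translate {P} {Q} ((a , b) , P⇔Q) =
  trans (sym (length-map (translate (a , b)) (cells P)))
        (↭-length (∼bag⇒↭ (unique∧set⇒bag
          (Uniqueₚ.map⁺ (translate-injective (a , b)) (distinct P)) (distinct Q) (mk⇔ to from))))
  where
  to : ∀ {d} → d ∈ map (translate (a , b)) (cells P) → d ∈ cells Q
  to d∈ with c , c∈ , refl ← ∈-map⁻ (translate (a , b)) d∈ = Equivalence.to (P⇔Q c) c∈
  from : ∀ {d} → d ∈ cells Q → d ∈ map (translate (a , b)) (cells P)
  from {d} d∈ =
    subst (_∈ map (translate (a , b)) (cells P)) (translate-inverse a b d)
      (∈-map⁺ (translate (a , b))
        (Equivalence.from (P⇔Q (translate (ℤ.- a , ℤ.- b) d))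
                          (subst (_∈ cells Q) (sym (translate-inverse a b d)) d∈)))

-- The polyomino of a profile

module ShapePolyomino {M f} (profile : Profile M f) where

  open Staircase profile
  open Profile profile

  rowShape : ℕ → List ℕ
  rowShape y = filter (λ x → inShape? M f x y) (downFrom (suc M))

  rowCells : ℕ → List Cell
  rowCells y = map (λ x → cell x y) (rowShape y)

  shapeCells : List Cell
  shapeCells = concatMap rowCells (downFrom (suc M))

  opaque
    ∈-shapeCells⁻ : ∀ {c} → c ∈ shapeCells → ∃₂ λ x y → c ≡ cell x y × Shape x y
    ∈-shapeCells⁻ c∈
      with y , _ , c∈row ← ∈-concatMap⇒∃ rowCells (downFrom (suc M)) c∈
      with x , x∈ , refl ← ∈-map⁻ (λ x → cell x y) c∈row =
      x , y , refl , proj₂ (∈-filter⁻ (λ x → inShape? M f x y) {xs = downFrom (suc M)} x∈)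

    ∈-shapeCells⁺ : ∀ {x y} → Shape x y → cell x y ∈ shapeCells
    ∈-shapeCells⁺ {x} {y} s =
      ∃⇒∈-concatMap rowCells (∈-downFrom⁺ (s≤s (InShape.y≤M s)))
        (∈-map⁺ (λ x → cell x y)
                (∈-filter⁺ (λ x → inShape? M f x y) (∈-downFrom⁺ (s≤s (InShape.x≤M s))) s))

  unique-shapeCells : Unique shapeCells
  unique-shapeCells =
    unique-concatMap rowCells (∣_∣ ∘ proj₂) inRow
      (λ y → Uniqueₚ.map⁺ (ℤₚ.+-injective ∘ cong proj₁)
                          (Uniqueₚ.filter⁺ (λ x → inShape? M f x y) (Uniqueₚ.downFrom⁺ (suc M))))
      (Uniqueₚ.downFrom⁺ (suc M))
    where
    inRow : ∀ {y c} → c ∈ rowCells y → ∣ proj₂ c ∣ ≡ y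
    inRow {y} c∈ with _ , _ , refl ← ∈-map⁻ (λ x → cell x y) c∈ = refl

  length-shapeCells : length shapeCells ≡ ∑□ (λ x y → 𝟙[ inShape? M f x y ])
  length-shapeCells =
    trans (length-concatMap rowCells (downFrom (suc M)))
          (sym (trans (∑<≡sum-downFrom (suc M) (λ y → ∑[ x < suc M ] 𝟙[ inShape? M f x y ]))
                      (cong sum (map-cong length-row (downFrom (suc M))))))
    where
    length-row : ∀ y → ∑[ x < suc M ] 𝟙[ inShape? M f x y ] ≡ length (rowCells y)
    length-row y = trans (∑<≡sum-downFrom (suc M) (λ x → 𝟙[ inShape? M f x y ]))
                         (sym (trans (length-map (λ x → cell x y) (rowShape y))
                                     (length-filter (λ x → inShape? M f x y) (downFrom (suc M)))))

  private
    _∈ₛ : ∀ {x y} → Shape x y → cell x y ∈ shapeCells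
    _∈ₛ = ∈-shapeCells⁺

  rightward : ∀ k {x y} → Shape x y → Shape (k + x) y → Path shapeCells (cell x y) (cell (k + x) y)
  rightward zero    s _ = stop (s ∈ₛ)
  rightward (suc k) {x} {y} s s′ =
    rightward k s mid ++ₚ step (mid ∈ₛ) (inj₂ (refl , ∣i-[1+i]∣≡1 (+ (k + x)))) (stop (s′ ∈ₛ))
    where
    mid : Shape (k + x) y
    mid = row-convex s s′ (m≤n+m x k) (n≤1+n (k + x))

  row-path : ∀ {x x' y} → Shape x y → Shape x' y → Path shapeCells (cell x y) (cell x' y)
  row-path {x} {x'} {y} s s′ with x ≤? x'
  ... | yes x≤x' = subst (λ t → Path shapeCells (cell x y) (cell t y)) (m∸n+n≡m x≤x')
                     (rightward (x' ∸ x) s (subst (λ t → Shape t y) (sym (m∸n+n≡m x≤x')) s′))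
  ... | no  x≰x' = reverseₚ (subst (λ t → Path shapeCells (cell x' y) (cell t y)) (m∸n+n≡m x'≤x)
                     (rightward (x ∸ x') s′ (subst (λ t → Shape t y) (sym (m∸n+n≡m x'≤x)) s)))
    where
    x'≤x : x' ≤ x
    x'≤x = <⇒≤ (≰⇒> x≰x')

  bottom-touch : Shape (M ∸ c) 0
  bottom-touch = rotate left-touch

  path-to-bottom : ∀ {x} y → Shape x y → Path shapeCells (cell x y) (cell (M ∸ c) 0)
  path-to-bottom zero    s = row-path s bottom-touch
  path-to-bottom (suc y) s with x° , s° , s°′ ← consecutive-rows-overlap y (InShape.y≤M s) =
    row-path s s°′ ++ₚ step (s°′ ∈ₛ) (inj₁ (refl , ∣[1+i]-i∣≡1 (+ y))) (path-to-bottom y s°)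

  shapeCells-connected : ∀ {c d} → c ∈ shapeCells → d ∈ shapeCells → Path shapeCells c d
  shapeCells-connected c∈ d∈
    with x , y , refl , s ← ∈-shapeCells⁻ c∈ | x' , y' , refl , s′ ← ∈-shapeCells⁻ d∈ =
    path-to-bottom y s ++ₚ reverseₚ (path-to-bottom y' s′)

  shapeCells-nonempty : shapeCells ≢ []
  shapeCells-nonempty shapeCells≡[] with () ← subst (cell 0 c ∈_) shapeCells≡[] (left-touch ∈ₛ)

  shapePolyomino : Polyomino
  shapePolyomino = record
    { cells     = shapeCells
    ; distinct  = unique-shapeCells
    ; nonempty  = shapeCells-nonempty
    ; connected = shapeCells-connected
    }

  shapePolyomino-convex : Convex shapePolyomino
  shapePolyomino-convex = rows , columns
    where
    rows : ∀ x₁ x₂ x y → (x₁ , y) ∈ shapeCells → (x₂ , y) ∈ shapeCells →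
           x₁ ℤ.≤ x → x ℤ.≤ x₂ → (x , y) ∈ shapeCells
    rows x₁ x₂ x y c₁∈ c₂∈ x₁≤x x≤x₂
      with _ , _ , refl , s₁ ← ∈-shapeCells⁻ c₁∈ | _ , _ , refl , s₂ ← ∈-shapeCells⁻ c₂∈
      with _ , refl ← nonnegative x₁≤x =
      row-convex s₁ s₂ (drop‿+≤+ x₁≤x) (drop‿+≤+ x≤x₂) ∈ₛ
    columns : ∀ x y₁ y₂ y → (x , y₁) ∈ shapeCells → (x , y₂) ∈ shapeCells →
              y₁ ℤ.≤ y → y ℤ.≤ y₂ → (x , y) ∈ shapeCells
    columns x y₁ y₂ y c₁∈ c₂∈ y₁≤y y≤y₂
      with _ , _ , refl , s₁ ← ∈-shapeCells⁻ c₁∈ | _ , _ , refl , s₂ ← ∈-shapeCells⁻ c₂∈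
      with _ , refl ← nonnegative y₁≤y =
      column-convex s₁ s₂ (drop‿+≤+ y₁≤y) (drop‿+≤+ y≤y₂) ∈ₛ

  quarterTurn-cell : ∀ {x y} → y ≤ M → quarterTurn (+ suc M) (cell x y) ≡ cell (M ∸ y) x
  quarterTurn-cell {x} {y} y≤M =
    cong₂ _,_ (trans (reflect (+ y) (+ M)) (trans (ℤₚ.m-n≡m⊖n M y) (ℤₚ.⊖-≥ y≤M)))
              (ℤₚ.+-identityʳ (+ x))
    where
    reflect : ∀ Y K → ℤ.- Y ℤ.- + 1 ℤ.+ (+ 1 ℤ.+ K) ≡ K ℤ.+ ℤ.- Y
    reflect = solve-∀

  shapePolyomino-rotInvariant : RotInvariant shapePolyomino
  shapePolyomino-rotInvariant = (+ suc M , + 0) , λ c → mk⇔ turn (turn³⇒∈ c)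
    where
    turn : ∀ {c} → c ∈ shapeCells → quarterTurn (+ suc M) c ∈ shapeCells
    turn c∈ with x , y , refl , s ← ∈-shapeCells⁻ c∈ =
      subst (_∈ shapeCells) (sym (quarterTurn-cell (InShape.y≤M s))) (rotate s ∈ₛ)
    turn³⇒∈ : ∀ c → quarterTurn (+ suc M) c ∈ shapeCells → c ∈ shapeCells
    turn³⇒∈ c qc∈ = subst (_∈ shapeCells) (quarterTurn⁴≡id (+ suc M) c) (turn (turn (turn qc∈)))

  private
    +M+1≡+[1+M] : + M ℤ.+ + 1 ≡ + suc M
    +M+1≡+[1+M] = cong +_ (+-comm M 1)

  shapePolyomino-width : HasWidth shapePolyomino (suc M)
  shapePolyomino-width =
    + 0 , bounds , (+ c , left-touch ∈ₛ) , (+ M , + (M ∸ c) , rotate² left-touch ∈ₛ , +M+1≡+[1+M])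
    where
    bounds : ∀ x y → (x , y) ∈ shapeCells → + 0 ℤ.≤ x × x ℤ.< + suc M
    bounds _ _ c∈ with _ , _ , refl , s ← ∈-shapeCells⁻ c∈ = ℤ.+≤+ z≤n , ℤ.+<+ (s≤s (InShape.x≤M s))

  shapePolyomino-height : HasHeight shapePolyomino (suc M)
  shapePolyomino-height =
    + 0 , bounds , (+ (M ∸ c) , bottom-touch ∈ₛ) ,
    (+ (M ∸ (M ∸ c)) , + M , rotate (rotate² left-touch) ∈ₛ , +M+1≡+[1+M])
    where
    bounds : ∀ x y → (x , y) ∈ shapeCells → + 0 ℤ.≤ y × y ℤ.< + suc M
    bounds _ _ c∈ with _ , _ , refl , s ← ∈-shapeCells⁻ c∈ = ℤ.+≤+ z≤n , ℤ.+<+ (s≤s (InShape.y≤M s))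

  shapePolyomino-halfPerimeter : HalfPerimeter shapePolyomino (2 * suc M)
  shapePolyomino-halfPerimeter =
    suc M , suc M , shapePolyomino-width , shapePolyomino-height , cong (_+_ (suc M)) (sym (+-identityʳ (suc M)))

  shapePolyomino-area : area shapePolyomino + 4 * ∑ᶠ ≡ suc M * suc M
  shapePolyomino-area = trans (cong (λ n → n + 4 * ∑ᶠ) length-shapeCells) area-identity

  cell∈⇒Shape : ∀ {x y} → cell x y ∈ shapeCells → Shape x y
  cell∈⇒Shape c∈ with _ , _ , refl , s ← ∈-shapeCells⁻ c∈ = s

-- Normalising a rotation-invariant convex polyomino

module Normalise (M : ℕ) (P : Polyomino) (convex : Convex P) (rotInvariant : RotInvariant P)
                 (halfPerimeter : HalfPerimeter P (2 * suc M)) where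

  w h : ℕ
  w = proj₁ halfPerimeter
  h = proj₁ (proj₂ halfPerimeter)

  width : HasWidth P w
  width = proj₁ (proj₂ (proj₂ halfPerimeter))

  height : HasHeight P h
  height = proj₁ (proj₂ (proj₂ (proj₂ halfPerimeter)))

  x₀ y₀ : ℤ
  x₀ = proj₁ width
  y₀ = proj₁ height

  S : ℕ → ℕ → Set
  S u t = (x₀ ℤ.+ + u , y₀ ℤ.+ + t) ∈ cells P

  record Located (X Y : ℤ) : Set where
    field
      u t : ℕ
      X≡  : X ≡ x₀ ℤ.+ + u
      Y≡  : Y ≡ y₀ ℤ.+ + t
      u<w : u < w
      t<h : t < h
      s   : S u t

  opaque
    locate : ∀ {X Y} → (X , Y) ∈ cells P → Located X Y
    locate {X} {Y} c∈
      with x₀≤X , X<x₀+w ← proj₁ (proj₂ width) X Y c∈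
         | y₀≤Y , Y<y₀+h ← proj₁ (proj₂ height) X Y c∈
      with u , refl ← ≤⇒offset x₀≤X | t , refl ← ≤⇒offset y₀≤Y =
      record { u = u ; t = t ; X≡ = refl ; Y≡ = refl
             ; u<w = drop‿+<+ (ℤ+-cancelˡ-< x₀ X<x₀+w) ; t<h = drop‿+<+ (ℤ+-cancelˡ-< y₀ Y<y₀+h)
             ; s = c∈ }

  v₁ v₂ α β : ℤ
  v₁ = proj₁ (proj₁ rotInvariant)
  v₂ = proj₂ (proj₁ rotInvariant)
  α = v₁ ℤ.- + 1 ℤ.- y₀ ℤ.- x₀
  β = x₀ ℤ.+ v₂ ℤ.- y₀

  -- In offset coordinates the symmetry of P is (u , t) ↦ (α - t , u + β).
  record Image (u t : ℕ) : Set where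
    field
      u' t' : ℕ
      α-t≡  : α ℤ.- + t ≡ + u'
      u+β≡  : + u ℤ.+ β ≡ + t'
      u'<w  : u' < w
      t'<h  : t' < h
      s     : S u' t'

  opaque
    image : ∀ {u t} → S u t → Image u t
    image {u} {t} s with located ← locate (Equivalence.to (proj₂ rotInvariant _) s) =
      record { u' = Located.u located ; t' = Located.t located
             ; α-t≡ = ℤ+-cancelˡ x₀ _ _ (trans (first x₀ y₀ v₁ (+ t)) (Located.X≡ located))
             ; u+β≡ = ℤ+-cancelˡ y₀ _ _ (trans (second x₀ y₀ v₂ (+ u)) (Located.Y≡ located))
             ; u'<w = Located.u<w located ; t'<h = Located.t<h located ; s = Located.s located }
      where
      first : ∀ x₀ y₀ v₁ t →
              x₀ ℤ.+ ((v₁ ℤ.- + 1 ℤ.- y₀ ℤ.- x₀) ℤ.- t) ≡ ℤ.- (y₀ ℤ.+ t) ℤ.- + 1 ℤ.+ v₁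
      first = solve-∀
      second : ∀ x₀ y₀ v₂ u → y₀ ℤ.+ (u ℤ.+ (x₀ ℤ.+ v₂ ℤ.- y₀)) ≡ (x₀ ℤ.+ u) ℤ.+ v₂
      second = solve-∀

  private
    offset-0 : ∀ k {t} → k ≡ k ℤ.+ + t → t ≡ 0
    offset-0 k {t} e = sym (ℤₚ.+-injective (ℤ+-cancelˡ k _ _ (trans (ℤₚ.+-identityʳ k) e)))

    offset-suc : ∀ k {t n} → (k ℤ.+ + t) ℤ.+ + 1 ≡ k ℤ.+ + n → suc t ≡ n
    offset-suc k {t} e = ℤₚ.+-injective (ℤ+-cancelˡ k _ _ (trans (sym (assoc k (+ t))) e))
      where
      assoc : ∀ k t → (k ℤ.+ t) ℤ.+ + 1 ≡ k ℤ.+ (+ 1 ℤ.+ t)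
      assoc = solve-∀

    a-b≡c⇒a≡c+b : ∀ {a b c} → + a ℤ.- + b ≡ + c → a ≡ c + b
    a-b≡c⇒a≡c+b {a} {b} {c} e = ℤₚ.+-injective (trans (sym (a-b+b≡a (+ a) (+ b))) (cong (ℤ._+ + b) e))
      where
      a-b+b≡a : ∀ a b → a ℤ.- b ℤ.+ b ≡ a
      a-b+b≡a = solve-∀

  -- The extreme cells of P, and where the symmetry sends them, pin down α, β, w and h.
  opaque
    bottom-cell : ∃ λ u → S u 0
    bottom-cell with located ← locate (proj₂ (proj₁ (proj₂ (proj₂ height))))
      with refl ← offset-0 y₀ (Located.Y≡ located) = Located.u located , Located.s located

    top-cell : ∃₂ λ u t → suc t ≡ h × S u t
    top-cell with _ , _ , c∈ , top ← proj₂ (proj₂ (proj₂ height)) with located ← locate c∈ =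
      Located.u located , Located.t located ,
      offset-suc y₀ (trans (cong (ℤ._+ + 1) (sym (Located.Y≡ located))) top) , Located.s located

    left-cell : ∃ λ t → S 0 t
    left-cell with located ← locate (proj₂ (proj₁ (proj₂ (proj₂ width))))
      with refl ← offset-0 x₀ (Located.X≡ located) = Located.t located , Located.s located

    right-cell : ∃₂ λ u t → suc u ≡ w × S u t
    right-cell with _ , _ , c∈ , right ← proj₂ (proj₂ (proj₂ width)) with located ← locate c∈ =
      Located.u located , Located.t located ,
      offset-suc x₀ (trans (cong (ℤ._+ + 1) (sym (Located.X≡ located))) right) , Located.s located

  αₙ : ℕ
  αₙ = Image.u' (image (proj₂ bottom-cell))

  αₙ<w : αₙ < w
  αₙ<w = Image.u'<w (image (proj₂ bottom-cell))

  α≡αₙ : α ≡ + αₙ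
  α≡αₙ = trans (sym (ℤₚ.+-identityʳ α)) (Image.α-t≡ (image (proj₂ bottom-cell)))

  βₙ : ℕ
  βₙ = Image.t' (image (proj₂ left-cell))

  β≡βₙ : β ≡ + βₙ
  β≡βₙ = trans (sym (ℤₚ.+-identityˡ β)) (Image.u+β≡ (image (proj₂ left-cell)))

  image-t' : ∀ {u t} (img : Image u t) → Image.t' img ≡ u + βₙ
  image-t' {u} img = sym (ℤₚ.+-injective (trans (cong (ℤ._+_ (+ u)) (sym β≡βₙ)) (Image.u+β≡ img)))

  t≤αₙ : ∀ {u t} (img : Image u t) → t ≤ αₙ
  t≤αₙ {t = t} img = subst (t ≤_) (sym αₙ≡u'+t) (m≤n+m t (Image.u' img))
    where
    αₙ≡u'+t : αₙ ≡ Image.u' img + t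
    αₙ≡u'+t = a-b≡c⇒a≡c+b (trans (cong (ℤ._- + t) (sym α≡αₙ)) (Image.α-t≡ img))

  h≤w : h ≤ w
  h≤w with _ , _ , 1+t≡h , s ← top-cell = subst (_≤ w) 1+t≡h (≤-trans (s≤s (t≤αₙ (image s))) αₙ<w)

  w≤h : w ≤ h
  w≤h with u , _ , 1+u≡w , s ← right-cell with img ← image s =
    subst (_≤ h) 1+u≡w (≤-trans (s≤s (m≤m+n u βₙ)) (subst (_< h) (image-t' img) (Image.t'<h img)))

  w≡h : w ≡ h
  w≡h = ≤-antisym w≤h h≤w

  w≡1+M : w ≡ suc M
  w≡1+M = *-cancelˡ-≡ w (suc M) 2
    (trans (cong (_+_ w) (trans (+-identityʳ w) w≡h)) (proj₂ (proj₂ (proj₂ (proj₂ halfPerimeter)))))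

  h≡1+M : h ≡ suc M
  h≡1+M = trans (sym w≡h) w≡1+M

  βₙ≡0 : βₙ ≡ 0
  βₙ≡0 with u , _ , 1+u≡w , s ← right-cell with img ← image s = n<1⇒n≡0 (+-cancelˡ-< u βₙ 1 u+βₙ<u+1)
    where
    u+βₙ<u+1 : u + βₙ < u + 1
    u+βₙ<u+1 = subst₂ _<_ (image-t' img) (trans (sym 1+u≡w) (+-comm 1 u))
                      (subst (Image.t' img <_) (sym w≡h) (Image.t'<h img))

  top-row-cell : ∃ λ u → S u M
  top-row-cell with u , _ , 1+t≡h , s ← top-cell = u , subst (S u) (suc-injective (trans 1+t≡h h≡1+M)) s

  α≡M : α ≡ + M
  α≡M with _ , s ← top-row-cell =
    trans α≡αₙ (cong +_ (≤-antisym (≤-pred (subst (αₙ <_) w≡1+M αₙ<w)) (t≤αₙ (image s))))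

  bounded : ∀ {u t} → S u t → u ≤ M × t ≤ M
  bounded {u} {t} s with located ← locate s =
    subst (_≤ M) (sym u≡) (≤-pred (subst (Located.u located <_) w≡1+M (Located.u<w located))) ,
    subst (_≤ M) (sym t≡) (≤-pred (subst (Located.t located <_) h≡1+M (Located.t<h located)))
    where
    u≡ : u ≡ Located.u located
    u≡ = ℤₚ.+-injective (ℤ+-cancelˡ x₀ _ _ (Located.X≡ located))
    t≡ : t ≡ Located.t located
    t≡ = ℤₚ.+-injective (ℤ+-cancelˡ y₀ _ _ (Located.Y≡ located))

  rotate : ∀ {u t} → S u t → S (M ∸ t) u
  rotate {u} {t} s with img ← image s =
    subst₂ S (ℤₚ.+-injective (trans (sym (Image.α-t≡ img)) (trans (cong (ℤ._- + t) α≡M) M-t≡M∸t)))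
             (trans (image-t' img) (trans (cong (_+_ u) βₙ≡0) (+-identityʳ u)))
             (Image.s img)
    where
    M-t≡M∸t : + M ℤ.- + t ≡ + (M ∸ t)
    M-t≡M∸t = trans (ℤₚ.m-n≡m⊖n M t) (ℤₚ.⊖-≥ (proj₂ (bounded s)))

  row-convex : ∀ {x₁ x₂ x y} → S x₁ y → S x₂ y → x₁ ≤ x → x ≤ x₂ → S x y
  row-convex s₁ s₂ x₁≤x x≤x₂ =
    proj₁ convex _ _ _ _ s₁ s₂ (ℤₚ.+-monoʳ-≤ x₀ (ℤ.+≤+ x₁≤x))
                               (ℤₚ.+-monoʳ-≤ x₀ (ℤ.+≤+ x≤x₂))

  column-convex : ∀ {x y₁ y₂ y} → S x y₁ → S x y₂ → y₁ ≤ y → y ≤ y₂ → S x y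
  column-convex s₁ s₂ y₁≤y y≤y₂ =
    proj₂ convex _ _ _ _ s₁ s₂ (ℤₚ.+-monoʳ-≤ y₀ (ℤ.+≤+ y₁≤y))
                               (ℤₚ.+-monoʳ-≤ y₀ (ℤ.+≤+ y≤y₂))

  rows-overlap : ∀ y → suc y ≤ M → ∃ λ x → S x y × S x (suc y)
  rows-overlap y 1+y≤M
    with _ , sb ← bottom-cell | _ , st ← top-row-cell
    with X , c∈ , c′∈ ← crossing (y₀ ℤ.+ + y) (connected P sb st)
                                 (ℤₚ.+-monoʳ-≤ y₀ (ℤ.+≤+ z≤n)) (ℤₚ.+-monoʳ-< y₀ (ℤ.+<+ 1+y≤M))
    with located ← locate c∈ =
    Located.u located , subst (λ X → S′ X y) (Located.X≡ located) c∈ ,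
    subst₂ (λ X Y → (X , Y) ∈ cells P) (Located.X≡ located) (suc-offset y₀ (+ y)) c′∈
    where
    S′ : ℤ → ℕ → Set
    S′ X t = (X , y₀ ℤ.+ + t) ∈ cells P
    suc-offset : ∀ k t → + 1 ℤ.+ (k ℤ.+ t) ≡ k ℤ.+ (+ 1 ℤ.+ t)
    suc-offset = solve-∀

  region : RotationInvariantRegion M S
  region = record
    { S? = λ u t → (x₀ ℤ.+ + u , y₀ ℤ.+ + t) ∈? cells P
    ; bounded = bounded ; row-convex = row-convex ; column-convex = column-convex
    ; rotate = rotate ; rows-overlap = rows-overlap ; bottom = bottom-cell }
    where open DecMembership (≡-dec ℤ._≟_ ℤ._≟_) using (_∈?_)

  ≈ₜ-region : (Q : Polyomino) → (∀ {u t} → S u t → cell u t ∈ cells Q) →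
              (∀ {c} → c ∈ cells Q → ∃₂ λ u t → c ≡ cell u t × S u t) → P ≈ₜ Q
  ≈ₜ-region Q into onto = (ℤ.- x₀ , ℤ.- y₀) , λ c → mk⇔ (to c) (from c)
    where
    shift-back : ∀ k i → (k ℤ.+ i) ℤ.+ ℤ.- k ≡ i
    shift-back = solve-∀
    shift-forth : ∀ k i → k ℤ.+ (i ℤ.+ ℤ.- k) ≡ i
    shift-forth = solve-∀
    to : ∀ c → c ∈ cells P → translate (ℤ.- x₀ , ℤ.- y₀) c ∈ cells Q
    to (X , Y) c∈ with record { u = u ; t = t ; X≡ = refl ; Y≡ = refl ; s = s } ← locate c∈ =
      subst (_∈ cells Q) (sym (cong₂ _,_ (shift-back x₀ (+ u)) (shift-back y₀ (+ t)))) (into s)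
    from : ∀ c → translate (ℤ.- x₀ , ℤ.- y₀) c ∈ cells Q → c ∈ cells P
    from (X , Y) c∈ with u , t , e , s ← onto c∈ =
      subst₂ (λ X Y → (X , Y) ∈ cells P)
             (trans (cong (ℤ._+_ x₀) (sym (cong proj₁ e))) (shift-forth x₀ X))
             (trans (cong (ℤ._+_ y₀) (sym (cong proj₂ e))) (shift-forth y₀ Y)) s

-- Codes, profiles and polyominoes

IsCounted : ℕ → ℕ → Polyomino → Set
IsCounted m k P = Convex P × RotInvariant P × HalfPerimeter P (2 * m) × area P ≡ k

codeProfile : ∀ {M F} → 1 ≤ M → Code (suc M) F → Profile M (entry F)
codeProfile {M} {i ∷ rows} 1≤M (i≤M∸1 , len , desc , bnd) = record
  { a         = i
  ; c         = suc (length rows)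
  ; a+c≡M     = trans (+-suc i (length rows))
                      (trans (cong (λ l → suc (i + l)) len)
                             (trans (cong suc (m+[n∸m]≡n i≤M∸1)) (m+[n∸m]≡n 1≤M)))
  ; antitone  = entry-antitone (bnd ∷ desc)
  ; f≤a       = entry-≤ (≤-refl ∷ bnd)
  ; vanishes  = entry-beyond (i ∷ rows)
  }

module CodeOfRegion {M S} (1≤M : 1 ≤ M) (region : RotationInvariantRegion M S) where

  open ProfileOfRegion region
  open Profile isProfile using (antitone; vanishes)

  rows : List ℕ
  rows = applyUpTo (profile ∘ suc) (M ∸ 1 ∸ profile 0)

  code : List ℕ
  code = profile 0 ∷ rows

  isCode : Code (suc M) code
  isCode =
    m+n≤o⇒m≤o∸n (profile 0) (subst (_≤ M) (+-comm 1 (profile 0)) (profile0<M 1≤M)) ,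
    length-applyUpTo (profile ∘ suc) (M ∸ 1 ∸ profile 0) ,
    AllPairsₚ.applyUpTo⁺₁ (profile ∘ suc) _ (λ i<j _ → antitone (s≤s (<⇒≤ i<j))) ,
    Allₚ.applyUpTo⁺₂ (profile ∘ suc) _ (λ _ → antitone z≤n)

  entry-code : ∀ y → entry code y ≡ profile y
  entry-code zero    = refl
  entry-code (suc y) with y <? M ∸ 1 ∸ profile 0
  ... | yes y<len = entry-applyUpTo (profile ∘ suc) _ y<len
  ... | no  y≮len =
    trans (entry-beyond rows (subst (_≤ y) (sym (length-applyUpTo (profile ∘ suc) _)) (≮⇒≥ y≮len)))
          (sym (vanishes M∸p0≤1+y))
    where
    M∸p0≤1+y : M ∸ profile 0 ≤ suc y
    M∸p0≤1+y = subst (_≤ suc y) 1+[M∸1∸p0]≡M∸p0 (s≤s (≮⇒≥ y≮len))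
      where
      1+[M∸1∸p0]≡M∸p0 : suc (M ∸ 1 ∸ profile 0) ≡ M ∸ profile 0
      1+[M∸1∸p0]≡M∸p0 = trans (cong suc (∸-+-assoc M 1 (profile 0))) (sym (+-∸-assoc 1 (profile0<M 1≤M)))

  region⇒shape : ∀ {x y} → S x y → InShape M (entry code) x y
  region⇒shape = InShape-cong (sym ∘ entry-code) ∘ to-shape

  shape⇒region : ∀ {x y} → InShape M (entry code) x y → S x y
  shape⇒region = from-shape ∘ InShape-cong entry-code

module _ {M f f'} (profile : Profile M f) (profile' : Profile M f') where

  private
    module A = ShapePolyomino profile
    module B = ShapePolyomino profile'

  profile-determined-by-shape : (∀ {x y} → InShape M f x y → InShape M f' x y) →
                                (∀ {x y} → InShape M f' x y → InShape M f x y) → ∀ y → f y ≡ f' y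
  profile-determined-by-shape f⇒f' f'⇒f y
    with x , y₁ , x≤ , y₁≤ , s ← Staircase.profile-attained profile y
       | x' , y₁' , x'≤ , y₁'≤ , s′ ← Staircase.profile-attained profile' y =
    ≤-antisym (Staircase.profile-lower-bound profile x'≤ y₁'≤ (f'⇒f s′))
              (Staircase.profile-lower-bound profile' x≤ y₁≤ (f⇒f' s))

  -- the shape touches the axes x = 0 and y = 0, and all cells have natural coordinates
  translation-nonnegative : (A≈B : A.shapePolyomino ≈ₜ B.shapePolyomino) →
                            (∃ λ x → proj₁ (proj₁ A≈B) ≡ + x) × (∃ λ y → proj₂ (proj₁ A≈B) ≡ + y)
  translation-nonnegative ((v₁ , v₂) , A⇔B)
    with x , _ , e , _ ← B.∈-shapeCells⁻
                           (Equivalence.to (A⇔B _) (A.∈-shapeCells⁺ (Staircase.left-touch profile)))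
       | _ , y , e′ , _ ← B.∈-shapeCells⁻ (Equivalence.to (A⇔B _) (A.∈-shapeCells⁺ A.bottom-touch)) =
    (x , trans (sym (ℤₚ.+-identityˡ v₁)) (cong proj₁ e)) ,
    (y , trans (sym (ℤₚ.+-identityˡ v₂)) (cong proj₂ e′))

  ≈ₜ-sym-shapes : A.shapePolyomino ≈ₜ B.shapePolyomino → B.shapePolyomino ≈ₜ A.shapePolyomino
  ≈ₜ-sym-shapes = ≈ₜ-sym {A.shapePolyomino} {B.shapePolyomino}

  untranslated⇒shape⊆ : (A≈B : A.shapePolyomino ≈ₜ B.shapePolyomino) → proj₁ A≈B ≡ (+ 0 , + 0) →
                        ∀ {x y} → InShape M f x y → InShape M f' x y
  untranslated⇒shape⊆ (_ , A⇔B) refl {x} {y} s =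
    B.cell∈⇒Shape (subst (_∈ B.shapeCells) (cong₂ _,_ (ℤₚ.+-identityʳ (+ x)) (ℤₚ.+-identityʳ (+ y)))
                         (Equivalence.to (A⇔B (cell x y)) (A.∈-shapeCells⁺ s)))

translate-shapePolyomino⇒≗ : ∀ {M f f'} (profile : Profile M f) (profile' : Profile M f') →
                             ShapePolyomino.shapePolyomino profile ≈ₜ ShapePolyomino.shapePolyomino profile' →
                             ∀ y → f y ≡ f' y
translate-shapePolyomino⇒≗ profile profile' A≈B =
  profile-determined-by-shape profile profile'
    (untranslated⇒shape⊆ profile profile' A≈B (cong₂ _,_ v₁≡0 v₂≡0))
    (untranslated⇒shape⊆ profile' profile B≈A (cong₂ _,_ (cong ℤ.-_ v₁≡0) (cong ℤ.-_ v₂≡0)))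
  where
  B≈A : ShapePolyomino.shapePolyomino profile' ≈ₜ ShapePolyomino.shapePolyomino profile
  B≈A = ≈ₜ-sym-shapes profile profile' A≈B
  v₁≡0 : proj₁ (proj₁ A≈B) ≡ + 0
  v₁≡0 = ≥0∧-≥0⇒≡0 (proj₁ (translation-nonnegative profile profile' A≈B))
                    (proj₁ (translation-nonnegative profile' profile B≈A))
  v₂≡0 : proj₂ (proj₁ A≈B) ≡ + 0
  v₂≡0 = ≥0∧-≥0⇒≡0 (proj₂ (translation-nonnegative profile profile' A≈B))
                    (proj₂ (translation-nonnegative profile' profile B≈A))

code-injective : ∀ {M F F'} (1≤M : 1 ≤ M) → Code (suc M) F → Code (suc M) F' →
                 (∀ y → entry F y ≡ entry F' y) → F ≡ F'
code-injective {F = F@(_ ∷ _)} {F'@(_ ∷ _)} 1≤M code code' F≗F' =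
  entry-injective F F' length≡ F≗F'
  where
  length≡ : length F ≡ length F'
  length≡ = +-cancelˡ-≡ (entry F 0) (length F) (length F')
              (trans (Profile.a+c≡M (codeProfile 1≤M code))
                     (trans (sym (Profile.a+c≡M (codeProfile 1≤M code')))
                            (cong (_+ length F') (sym (F≗F' 0)))))

module _ {M} (1≤M : 1 ≤ M) where

  opaque
    codePolyomino : ∀ {F} → Code (suc M) F → Polyomino
    codePolyomino code = ShapePolyomino.shapePolyomino (codeProfile 1≤M code)

    codePolyomino-convex : ∀ {F} (code : Code (suc M) F) → Convex (codePolyomino code)
    codePolyomino-convex code = ShapePolyomino.shapePolyomino-convex (codeProfile 1≤M code)

    codePolyomino-rotInvariant : ∀ {F} (code : Code (suc M) F) → RotInvariant (codePolyomino code)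
    codePolyomino-rotInvariant code = ShapePolyomino.shapePolyomino-rotInvariant (codeProfile 1≤M code)

    codePolyomino-halfPerimeter : ∀ {F} (code : Code (suc M) F) →
                                  HalfPerimeter (codePolyomino code) (2 * suc M)
    codePolyomino-halfPerimeter code = ShapePolyomino.shapePolyomino-halfPerimeter (codeProfile 1≤M code)

    codePolyomino-area : ∀ {F} (code : Code (suc M) F) →
                         area (codePolyomino code) + 4 * sum F ≡ suc M * suc M
    codePolyomino-area {F@(_ ∷ _)} code =
      trans (cong (λ s → area shapePolyomino + 4 * s) (sym (∑<-entry F (suc M) length≤)))
            shapePolyomino-area
      where
      open ShapePolyomino (codeProfile 1≤M code)
      open Profile (codeProfile 1≤M code) using (a; c; a+c≡M)
      length≤ : length F ≤ suc M
      length≤ = m≤n⇒m≤1+n (subst (c ≤_) a+c≡M (m≤n+m c a))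

    codePolyomino-injective : ∀ {F F'} (code : Code (suc M) F) (code' : Code (suc M) F') →
                              codePolyomino code ≈ₜ codePolyomino code' → F ≡ F'
    codePolyomino-injective code code' P≈P' =
      code-injective 1≤M code code'
        (translate-shapePolyomino⇒≗ (codeProfile 1≤M code) (codeProfile 1≤M code') P≈P')

    -- for every proof that F is a code, as the polyominoes are listed from other proofs
    polyomino⇒code : ∀ P → Convex P → RotInvariant P → HalfPerimeter P (2 * suc M) →
                     ∃ λ F → Code (suc M) F × (∀ code → P ≈ₜ codePolyomino {F} code)
    polyomino⇒code P convex rotInvariant halfPerimeter = code , isCode , λ code′ →
      ≈ₜ-region (codePolyomino code′)
        (ShapePolyomino.∈-shapeCells⁺ (codeProfile 1≤M code′) ∘ region⇒shape)
        (λ c∈ → let x , y , c≡ , s = ShapePolyomino.∈-shapeCells⁻ (codeProfile 1≤M code′) c∈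
                in x , y , c≡ , shape⇒region s)
      where
      open Normalise M P convex rotInvariant halfPerimeter using (region; ≈ₜ-region)
      open CodeOfRegion 1≤M region

  opaque
    listedPolyomino : ∀ k {F} → F ∈ codesOfArea (suc M) k → Polyomino
    listedPolyomino k F∈ = codePolyomino (proj₁ (∈-codesOfArea⁻ (suc M) k F∈))

    listedPolyomino-counted : ∀ k {F} (F∈ : F ∈ codesOfArea (suc M) k) →
                              IsCounted (suc M) k (listedPolyomino k F∈)
    listedPolyomino-counted k {F} F∈ =
      codePolyomino-convex code , codePolyomino-rotInvariant code , codePolyomino-halfPerimeter code ,
      +-cancelʳ-≡ (4 * sum F) (area (codePolyomino code)) k (trans (codePolyomino-area code) (sym area≡))
      where
      code : Code (suc M) F
      code = proj₁ (∈-codesOfArea⁻ (suc M) k F∈)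
      area≡ : k + 4 * sum F ≡ suc M * suc M
      area≡ = proj₂ (∈-codesOfArea⁻ (suc M) k F∈)

    listedPolyomino-injective : ∀ k {F F'} (F∈ : F ∈ codesOfArea (suc M) k) (F'∈ : F' ∈ codesOfArea (suc M) k) →
                                listedPolyomino k F∈ ≈ₜ listedPolyomino k F'∈ → F ≡ F'
    listedPolyomino-injective k F∈ F'∈ =
      codePolyomino-injective (proj₁ (∈-codesOfArea⁻ (suc M) k F∈)) (proj₁ (∈-codesOfArea⁻ (suc M) k F'∈))

    counted⇒listed : ∀ k {P} → IsCounted (suc M) k P →
                     ∃ λ F → Σ (F ∈ codesOfArea (suc M) k) λ F∈ → P ≈ₜ listedPolyomino k F∈
    counted⇒listed k {P} (convex , rotInvariant , halfPerimeter , area≡k)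
      with F , code , P≈ ← polyomino⇒code P convex rotInvariant halfPerimeter =
      F , F∈ , P≈ (proj₁ (∈-codesOfArea⁻ (suc M) k F∈))
      where
      F∈ : F ∈ codesOfArea (suc M) k
      F∈ = ∈-codesOfArea⁺ (suc M) k code
             (trans (cong (_+ 4 * sum F) (trans (sym area≡k) (area-translate {P} {codePolyomino code} (P≈ code))))
                    (codePolyomino-area code))

mainTheorem11 : ∀ (m : ℕ) → 2 ≤ m → ∀ (k : ℕ) → RotConvexAreaCount m k (rhsCoef m k)
mainTheorem11 m@(suc M@(suc _)) (s≤s (s≤s z≤n)) k =
  mapWith∈ (codesOfArea m k) polyomino ,
  trans (length-mapWith∈ (codesOfArea m k) polyomino) (length-codesOfArea m k) ,
  All-mapWith∈ (codesOfArea m k) polyomino (listedPolyomino-counted 1≤M k) ,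
  AllPairs-mapWith∈ polyomino (unique-codesOfArea m k)
    (λ F∈ F'∈ F≢F' → F≢F' ∘ listedPolyomino-injective 1≤M k F∈ F'∈) ,
  λ P counted → mapWith∈⁺ polyomino (counted⇒listed 1≤M k {P} counted)
  where
  1≤M : 1 ≤ M
  1≤M = s≤s z≤n
  polyomino : ∀ {F} → F ∈ codesOfArea m k → Polyomino
  polyomino = listedPolyomino 1≤M k
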